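{- Let $\mathcal{N}$ be the class of simple binary matroids that do not have $M(K_4)$ as an induced minor. If $N$ is a member of $\mathcal{N}$ having no triangles (3-element circuits), then the tipless coning $A(N)\backslash p$ is in $\mathcal{N}$.
   Context: All matroids are simple and binary; every contraction is immediately followed by simplification. An induced minor of $M$ is a matroid obtained from $M$ by a sequence of restrictions to flats and contractions (each contraction followed by simplification). For a simple binary matroid $N$ (viewed as a restriction of a binary projective geometry), its coning $A(N)$ is obtained by adding a coloop $p$ (the tip) to $N$ and then adding the third point on each projective line between $p$ and a point of $N$; the tipless coning is $A(N)\backslash p$. -}

module Defs where

open import Data.Bool using (Bool; true; false; _∧_; _∨_; _xor_; if_then_else_)
open import Data.Nat using (ℕ; zero; suc; _+_)
open import Data.Fin using (Fin; zero; suc; _≟_; splitAt; join)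
open import Data.Fin.Properties using (join-splitAt)
open import Data.Vec using (Vec; []; _∷_; replicate; zipWith)
open import Data.List using (allFin)
open import Data.Bool.ListAction using (any)
open import Data.Sum using (_⊎_; inj₁; inj₂)
open import Data.Product using (Σ; _×_; _,_; ∃)
open import Relation.Nullary using (¬_; Dec; yes; no)
open import Relation.Nullary.Decidable using (⌊_⌋)
open import Relation.Binary.PropositionalEquality using (_≡_; _≢_; refl; cong; trans; sym)
open import Function using (_∘_; _⇔_)
open import Function.Definitions using (Injective; Surjective)

zeroV : ∀ {n} → Vec Bool n
zeroV {n} = replicate n false

_⊕_ : ∀ {n} → Vec Bool n → Vec Bool n → Vec Bool n
_⊕_ = zipWith _xor_

lincomb : ∀ {m n} → (Fin m → Vec Bool n) → (Fin m → Bool) → Vec Bool n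
lincomb {zero}  v c = zeroV
lincomb {suc m} v c =
  (if c zero then v zero ⊕ lincomb (v ∘ suc) (c ∘ suc) else lincomb (v ∘ suc) (c ∘ suc))

Subset : ℕ → Set
Subset m = Fin m → Bool

_⊆_ : ∀ {m} → Subset m → Subset m → Set
X ⊆ Y = ∀ i → X i ≡ true → Y i ≡ true

⁅_⁆ : ∀ {m} → Fin m → Subset m
⁅ i ⁆ j = ⌊ j ≟ i ⌋

_∪_ : ∀ {m} → Subset m → Subset m → Subset m
infixr 20 _∪_
(X ∪ Y) j = X j ∨ Y j

img : ∀ {m k} → (Fin k → Fin m) → Subset k → Subset m
img {k = k} φ X j = any (λ i → X i ∧ ⌊ φ i ≟ j ⌋) (allFin k)

-- Simple binary matroids: a finite set of distinct nonzero vectors of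
-- GF(2)^n (a restriction of the binary projective geometry PG(n-1,2)),
-- with ground set indexed by Fin m.

record SBM : Set where
  field
    m    : ℕ
    n    : ℕ
    vec  : Fin m → Vec Bool n
    nonzero  : ∀ i → vec i ≢ zeroV
    distinct : Injective _≡_ _≡_ vec
open SBM public

Indep : (M : SBM) → Subset (m M) → Set
Indep M X = ∀ (c : Subset (m M)) → c ⊆ X → lincomb (vec M) c ≡ zeroV → ∀ i → c i ≡ false

-- flats: closed sets, i.e. cl(F) = F:
-- every e ∉ F extends every independent subset of F to an independent set
IsFlat : (M : SBM) → Subset (m M) → Set
IsFlat M F = ∀ e → F e ≡ false → ∀ I → I ⊆ F → Indep M I → Indep M (I ∪ ⁅ e ⁆)

Iso : SBM → SBM → Set
Iso N M = Σ (Fin (m N) → Fin (m M)) λ φ →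
  Injective _≡_ _≡_ φ × Surjective _≡_ _≡_ φ ×
  (∀ X → Indep N X ⇔ Indep M (img φ X))

RestrFlat : SBM → SBM → Set
RestrFlat N M = Σ (Fin (m N) → Fin (m M)) λ φ → Σ (Subset (m M)) λ F →
  IsFlat M F × Injective _≡_ _≡_ φ ×
  (∀ j → F j ≡ true → ∃ λ i → φ i ≡ j) ×
  (∀ i → F (φ i) ≡ true) ×
  (∀ X → Indep N X ⇔ Indep M (img φ X))

-- N is (isomorphic to) si(M/e), the simplification of the contraction
-- of M by an element e.  φ picks one representative of each parallel
-- class of M/e; f, g are parallel in M/e iff {f,g,e} is dependent in M,
-- and X is independent in M/e iff X ∪ {e} is independent in M.
ContrSi : SBM → SBM → Set
ContrSi N M = Σ (Fin (m M)) λ e → Σ (Fin (m N) → Fin (m M)) λ φ →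
  Injective _≡_ _≡_ φ ×
  (∀ i → φ i ≢ e) ×
  (∀ f → f ≢ e → ∃ λ i → (f ≡ φ i) ⊎ ¬ Indep M (⁅ f ⁆ ∪ ⁅ φ i ⁆ ∪ ⁅ e ⁆)) ×
  (∀ X → Indep N X ⇔ Indep M (img φ X ∪ ⁅ e ⁆))

data Step (N M : SBM) : Set where
  restr  : RestrFlat N M → Step N M
  contr  : ContrSi N M → Step N M

data IndMinor (N : SBM) : SBM → Set₁ where
  done : ∀ {M} → Iso N M → IndMinor N M
  step : ∀ {M M₁} → Step M₁ M → IndMinor N M₁ → IndMinor N M

-- M(K4): cycle matroid of K4, represented by the incidence vectors
-- e_a + e_b ∈ GF(2)^4 of its six edges ab.

K4edge : Fin 6 → Vec Bool 4
K4edge zero                               = true  ∷ true  ∷ false ∷ false ∷ []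
K4edge (suc zero)                         = true  ∷ false ∷ true  ∷ false ∷ []
K4edge (suc (suc zero))                   = true  ∷ false ∷ false ∷ true  ∷ []
K4edge (suc (suc (suc zero)))             = false ∷ true  ∷ true  ∷ false ∷ []
K4edge (suc (suc (suc (suc zero))))       = false ∷ true  ∷ false ∷ true  ∷ []
K4edge (suc (suc (suc (suc (suc zero))))) = false ∷ false ∷ true  ∷ true  ∷ []

K4edge-nonzero : ∀ i → K4edge i ≢ zeroV
K4edge-nonzero zero ()
K4edge-nonzero (suc zero) ()
K4edge-nonzero (suc (suc zero)) ()
K4edge-nonzero (suc (suc (suc zero))) ()
K4edge-nonzero (suc (suc (suc (suc zero)))) ()
K4edge-nonzero (suc (suc (suc (suc (suc zero))))) ()

K4edge-inj : Injective _≡_ _≡_ K4edge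
K4edge-inj {zero} {zero} _ = refl
K4edge-inj {suc zero} {suc zero} _ = refl
K4edge-inj {suc (suc zero)} {suc (suc zero)} _ = refl
K4edge-inj {suc (suc (suc zero))} {suc (suc (suc zero))} _ = refl
K4edge-inj {suc (suc (suc (suc zero)))} {suc (suc (suc (suc zero)))} _ = refl
K4edge-inj {suc (suc (suc (suc (suc zero))))} {suc (suc (suc (suc (suc zero))))} _ = refl
K4edge-inj {zero} {suc zero} ()
K4edge-inj {zero} {suc (suc zero)} ()
K4edge-inj {zero} {suc (suc (suc zero))} ()
K4edge-inj {zero} {suc (suc (suc (suc zero)))} ()
K4edge-inj {zero} {suc (suc (suc (suc (suc zero))))} ()
K4edge-inj {suc zero} {zero} ()
K4edge-inj {suc zero} {suc (suc zero)} ()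
K4edge-inj {suc zero} {suc (suc (suc zero))} ()
K4edge-inj {suc zero} {suc (suc (suc (suc zero)))} ()
K4edge-inj {suc zero} {suc (suc (suc (suc (suc zero))))} ()
K4edge-inj {suc (suc zero)} {zero} ()
K4edge-inj {suc (suc zero)} {suc zero} ()
K4edge-inj {suc (suc zero)} {suc (suc (suc zero))} ()
K4edge-inj {suc (suc zero)} {suc (suc (suc (suc zero)))} ()
K4edge-inj {suc (suc zero)} {suc (suc (suc (suc (suc zero))))} ()
K4edge-inj {suc (suc (suc zero))} {zero} ()
K4edge-inj {suc (suc (suc zero))} {suc zero} ()
K4edge-inj {suc (suc (suc zero))} {suc (suc zero)} ()
K4edge-inj {suc (suc (suc zero))} {suc (suc (suc (suc zero)))} ()
K4edge-inj {suc (suc (suc zero))} {suc (suc (suc (suc (suc zero))))} ()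
K4edge-inj {suc (suc (suc (suc zero)))} {zero} ()
K4edge-inj {suc (suc (suc (suc zero)))} {suc zero} ()
K4edge-inj {suc (suc (suc (suc zero)))} {suc (suc zero)} ()
K4edge-inj {suc (suc (suc (suc zero)))} {suc (suc (suc zero))} ()
K4edge-inj {suc (suc (suc (suc zero)))} {suc (suc (suc (suc (suc zero))))} ()
K4edge-inj {suc (suc (suc (suc (suc zero))))} {zero} ()
K4edge-inj {suc (suc (suc (suc (suc zero))))} {suc zero} ()
K4edge-inj {suc (suc (suc (suc (suc zero))))} {suc (suc zero)} ()
K4edge-inj {suc (suc (suc (suc (suc zero))))} {suc (suc (suc zero))} ()
K4edge-inj {suc (suc (suc (suc (suc zero))))} {suc (suc (suc (suc zero)))} ()

MK4 : SBM
MK4 = record { m = 6 ; n = 4 ; vec = K4edge ; nonzero = K4edge-nonzero ; distinct = K4edge-inj }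

InN : SBM → Set₁
InN M = ¬ IndMinor MK4 M

Triangle : (M : SBM) → Fin (m M) → Fin (m M) → Fin (m M) → Set
Triangle M i j k =
  i ≢ j × i ≢ k × j ≢ k ×
  ¬ Indep M (⁅ i ⁆ ∪ ⁅ j ⁆ ∪ ⁅ k ⁆) ×
  Indep M (⁅ i ⁆ ∪ ⁅ j ⁆) × Indep M (⁅ i ⁆ ∪ ⁅ k ⁆) × Indep M (⁅ j ⁆ ∪ ⁅ k ⁆)

TriangleFree : SBM → Set
TriangleFree M = ∀ i j k → ¬ Triangle M i j k

-- A(N) lives in GF(2)^(1+n): tip p = (1,0,…,0) (a
-- coloop), N embedded as (0,v); the third point on the line through p
-- and (0,v) is (1,v).

coneVec′ : ∀ {m n} → (Fin m → Vec Bool n) → Fin m ⊎ Fin m → Vec Bool (suc n)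
coneVec′ v (inj₁ i) = false ∷ v i
coneVec′ v (inj₂ i) = true  ∷ v i

coneVec : ∀ {m n} → (Fin m → Vec Bool n) → Fin (m + m) → Vec Bool (suc n)
coneVec {m} v x = coneVec′ v (splitAt m x)

private
  ∷-inj : ∀ {n} {a b : Bool} {u w : Vec Bool n} → a ∷ u ≡ b ∷ w → u ≡ w
  ∷-inj refl = refl

  coneVec′-inj : ∀ {m n} (v : Fin m → Vec Bool n) → Injective _≡_ _≡_ v →
                 ∀ x y → coneVec′ v x ≡ coneVec′ v y → x ≡ y
  coneVec′-inj v inj (inj₁ i) (inj₁ j) eq = cong inj₁ (inj (∷-inj eq))
  coneVec′-inj v inj (inj₂ i) (inj₂ j) eq = cong inj₂ (inj (∷-inj eq))
  coneVec′-inj v inj (inj₁ i) (inj₂ j) ()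
  coneVec′-inj v inj (inj₂ i) (inj₁ j) ()

coneVec-nonzero : ∀ {m n} (v : Fin m → Vec Bool n) → (∀ i → v i ≢ zeroV) →
                  ∀ x → coneVec v x ≢ zeroV
coneVec-nonzero {m} v nz x with splitAt m x
... | inj₁ i = λ eq → nz i (∷-inj eq)
... | inj₂ i = λ ()

coneVec-inj : ∀ {m n} (v : Fin m → Vec Bool n) → Injective _≡_ _≡_ v →
              Injective _≡_ _≡_ (coneVec v)
coneVec-inj {m} v inj {x} {y} eq =
  trans (sym (join-splitAt m m x))
    (trans (cong (join m m) (coneVec′-inj v inj (splitAt m x) (splitAt m y) eq))
           (join-splitAt m m y))

TiplessCone : SBM → SBM
TiplessCone N = record
  { m = m N + m N
  ; n = suc (n N)
  ; vec = coneVec (vec N)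
  ; nonzero = coneVec-nonzero (vec N) (nonzero N)
  ; distinct = coneVec-inj (vec N) (distinct N)
  }

-- An induced M(K₄) minor of a binary matroid M can be described by a copy ψ of the six edges of K₄ in M
-- together with an independent set C to be contracted: modulo the span ⟨C⟩ the copy has exactly the cycles
-- of K₄, and every element of M lying in ⟨ψ ∪ C⟩ is, modulo ⟨C⟩, zero or equal to an element of the copy.
-- Conversely, such a copy is realised as an induced minor by contracting the elements of C one at a time
-- (each contraction is a projection along the contracted vector) and restricting to the flat of the copy.
--
-- Take such a copy in A(N)\p and look at the tip p. If p ∈ ⟨C⟩ it can replace an element of C, and if
-- p ∉ ⟨ψ ∪ C⟩ it can be added to C. Either way the copy presents M(K₄) in A(N) with p contracted, and
-- A(N)/p simplifies to N, so M(K₄) would be an induced minor of N. In the remaining case p ≡ Σψ(b) modulo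
-- ⟨C⟩ for a set b of edges. The partners x + p of the copy elements x lie in ⟨ψ ∪ C⟩ as well, and this
-- forces the edges of b to sum to that of a perfect matching, and then C = ∅. So p is the sum of two
-- opposite copy elements, and projecting a triangle of the copy from p gives a triangle of N.

{-# OPTIONS --safe #-}
module Submission where

open import Data.Bool using (Bool; true; false; _∧_; _∨_; _xor_; not)
open import Data.Bool.ListAction using (or)
open import Data.Bool.Properties
  using (xor-same; xor-assoc; xor-comm; xor-identityˡ; xor-identityʳ; ∨-assoc; ∨-comm; ∨-identityʳ; ∨-zeroʳ;
         ∧-identityʳ; ∧-zeroʳ; ¬-not; T-≡; T-∧)
  renaming (_≟_ to _≟ᵇ_)
open import Data.Bool.Solver using (module ∨-∧-Solver; module xor-∧-Solver)
open import Data.Empty using (⊥; ⊥-elim)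
open import Data.Fin using (Fin; zero; suc; _≟_; _<_; splitAt; join; _↑ˡ_)
open import Data.Fin.Properties using (suc-injective; 0≢1+n; any?; all?; <-cmp; <-asym; _<?_; splitAt-↑ˡ; splitAt-join)
open import Data.Fin.Subset.Properties using (anySubset?)
open import Data.List as List using (List; []; _∷_; allFin; filter)
open import Data.List.Membership.Propositional using (lose; find)
open import Data.List.Membership.Propositional.Properties using (∈-allFin; ∈-filter⁺; ∈-filter⁻; ∈-lookup)
open import Data.List.Properties using (map-tabulate; filter-notAll; length-tabulate)
open import Data.List.Relation.Unary.All as All using (All)
open import Data.List.Relation.Unary.Any as Any using (Any; satisfied)
open import Data.List.Relation.Unary.Any.Properties using (any⁺; any⁻; lookup-index)
open import Data.List.Relation.Unary.Unique.Propositional using (Unique; _∷_)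
import Data.List.Relation.Unary.Unique.Propositional.Properties as Unique
open import Data.Nat using (ℕ; zero; suc) renaming (_<_ to _<ℕ_)
open import Data.Nat.Induction using (<-wellFounded)
open import Data.Product using (_×_; _,_; ∃; proj₁; proj₂)
open import Data.Sum using (_⊎_; inj₁; inj₂; [_,_]′; swap)
open import Data.Unit using (tt)
open import Data.Vec using (Vec; []; _∷_; lookup; tabulate; foldr; tail)
open import Data.Vec.Properties
  using (zipWith-comm; zipWith-assoc; zipWith-identityˡ; zipWith-identityʳ; lookup-zipWith; lookup∘tabulate)
  renaming (≡-dec to ≡-decᵛ)
open import Function using (_∘_; _⇔_; mk⇔; Equivalence; id)
open import Function.Construct.Composition using (_⇔-∘_)
open import Function.Definitions using (Injective)
open import Induction.WellFounded using (Acc; acc)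
open import Relation.Binary using (tri<; tri≈; tri>)
open import Relation.Binary.PropositionalEquality
open import Relation.Nullary using (¬_; Dec; yes; no)
open import Relation.Nullary.Decidable
  using (⌊_⌋; _×-dec_; _→-dec_; ¬?; map′; toWitness; fromWitness; decidable-stable)

open import Defs

open Equivalence using (to; from)

⊕-comm : ∀ {n} (u w : Vec Bool n) → u ⊕ w ≡ w ⊕ u
⊕-comm = zipWith-comm xor-comm

⊕-assoc : ∀ {n} (u v w : Vec Bool n) → (u ⊕ v) ⊕ w ≡ u ⊕ (v ⊕ w)
⊕-assoc = zipWith-assoc xor-assoc

⊕-identityˡ : ∀ {n} (u : Vec Bool n) → zeroV ⊕ u ≡ u
⊕-identityˡ = zipWith-identityˡ xor-identityˡ

⊕-identityʳ : ∀ {n} (u : Vec Bool n) → u ⊕ zeroV ≡ u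
⊕-identityʳ = zipWith-identityʳ xor-identityʳ

⊕-self : ∀ {n} (u : Vec Bool n) → u ⊕ u ≡ zeroV
⊕-self []      = refl
⊕-self (a ∷ u) = cong₂ _∷_ (xor-same a) (⊕-self u)

⊕-cancelˡ : ∀ {n} (u w : Vec Bool n) → u ⊕ (u ⊕ w) ≡ w
⊕-cancelˡ u w = begin
  u ⊕ (u ⊕ w)  ≡⟨ ⊕-assoc u u w ⟨
  (u ⊕ u) ⊕ w  ≡⟨ cong (_⊕ w) (⊕-self u) ⟩
  zeroV ⊕ w    ≡⟨ ⊕-identityˡ w ⟩
  w            ∎
  where open ≡-Reasoning

⊕-cancelʳ : ∀ {n} (w u : Vec Bool n) → (w ⊕ u) ⊕ u ≡ w
⊕-cancelʳ w u = trans (⊕-assoc w u u) (trans (cong (w ⊕_) (⊕-self u)) (⊕-identityʳ w))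

⊕≡0⇒≡ : ∀ {n} {u w : Vec Bool n} → u ⊕ w ≡ zeroV → u ≡ w
⊕≡0⇒≡ {u = u} {w} eq = begin
  u              ≡⟨ ⊕-cancelʳ u w ⟨
  (u ⊕ w) ⊕ w    ≡⟨ cong (_⊕ w) eq ⟩
  zeroV ⊕ w      ≡⟨ ⊕-identityˡ w ⟩
  w              ∎
  where open ≡-Reasoning

⊕≡⇒≡⊕ : ∀ {n} {u w v : Vec Bool n} → u ⊕ w ≡ v → u ≡ v ⊕ w
⊕≡⇒≡⊕ {u = u} {w} eq = trans (sym (⊕-cancelʳ u w)) (cong (_⊕ w) eq)

⊕-rotate : ∀ {n} (a b c : Vec Bool n) → (a ⊕ b) ⊕ c ≡ (b ⊕ c) ⊕ a
⊕-rotate a b c = trans (⊕-assoc a b c) (⊕-comm a (b ⊕ c))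

⊕-interchange : ∀ {n} (a b c d : Vec Bool n) → (a ⊕ b) ⊕ (c ⊕ d) ≡ (a ⊕ c) ⊕ (b ⊕ d)
⊕-interchange a b c d = begin
  (a ⊕ b) ⊕ (c ⊕ d)   ≡⟨ ⊕-assoc a b (c ⊕ d) ⟩
  a ⊕ (b ⊕ (c ⊕ d))   ≡⟨ cong (a ⊕_) (⊕-assoc b c d) ⟨
  a ⊕ ((b ⊕ c) ⊕ d)   ≡⟨ cong (λ x → a ⊕ (x ⊕ d)) (⊕-comm b c) ⟩
  a ⊕ ((c ⊕ b) ⊕ d)   ≡⟨ cong (a ⊕_) (⊕-assoc c b d) ⟩
  a ⊕ (c ⊕ (b ⊕ d))   ≡⟨ ⊕-assoc a c (b ⊕ d) ⟨
  (a ⊕ c) ⊕ (b ⊕ d)   ∎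
  where open ≡-Reasoning

⊕-cancel-common : ∀ {n} (x y z : Vec Bool n) → (x ⊕ y) ⊕ (x ⊕ z) ≡ y ⊕ z
⊕-cancel-common x y z = trans (⊕-interchange x y x z) (trans (cong (_⊕ (y ⊕ z)) (⊕-self x)) (⊕-identityˡ (y ⊕ z)))

infix 4 _≟ᵛ_

_≟ᵛ_ : ∀ {n} (u w : Vec Bool n) → Dec (u ≡ w)
_≟ᵛ_ = ≡-decᵛ _≟ᵇ_

module _ {m : ℕ} where

  infix 4 _∈_ _∉_ _≐_
  infixr 20 _⊻_ _∩_
  infixl 25 _∖_
  infixr 30 _·ₛ_

  _∈_ _∉_ : Fin m → Subset m → Set
  i ∈ X = X i ≡ true
  i ∉ X = X i ≡ false

  _≐_ : Subset m → Subset m → Set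
  X ≐ Y = ∀ i → X i ≡ Y i

  ∅ full : Subset m
  ∅    _ = false
  full _ = true

  _⊻_ _∩_ _∖_ : Subset m → Subset m → Subset m
  (X ⊻ Y) i = X i xor Y i
  (X ∩ Y) i = X i ∧ Y i
  (X ∖ Y) i = X i ∧ not (Y i)

  _·ₛ_ : Bool → Subset m → Subset m
  (b ·ₛ X) i = b ∧ X i

  Disjoint : Subset m → Subset m → Set
  Disjoint X Y = ∀ i → i ∈ X → i ∉ Y

∉⇒¬∈ : ∀ {b : Bool} → b ≡ false → ¬ b ≡ true
∉⇒¬∈ refl ()

¬∈⇒∉ : ∀ {b : Bool} → ¬ b ≡ true → b ≡ false
¬∈⇒∉ = ¬-not

≐-refl : ∀ {m} {X : Subset m} → X ≐ X
≐-refl _ = refl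

≐-sym : ∀ {m} {X Y : Subset m} → X ≐ Y → Y ≐ X
≐-sym e i = sym (e i)

≐-trans : ∀ {m} {X Y Z : Subset m} → X ≐ Y → Y ≐ Z → X ≐ Z
≐-trans e f i = trans (e i) (f i)

⊆-trans : ∀ {m} {X Y Z : Subset m} → X ⊆ Y → Y ⊆ Z → X ⊆ Z
⊆-trans a b i h = b i (a i h)

≐⇒⊆ : ∀ {m} {X Y : Subset m} → X ≐ Y → X ⊆ Y
≐⇒⊆ e i h = trans (sym (e i)) h

⊆-antisym : ∀ {m} {X Y : Subset m} → X ⊆ Y → Y ⊆ X → X ≐ Y
⊆-antisym {X = X} {Y} a b i with X i in xi | Y i in yi
... | true  | true  = refl
... | false | false = refl
... | true  | false = ⊥-elim (∉⇒¬∈ yi (a i xi))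
... | false | true  = ⊥-elim (∉⇒¬∈ xi (b i yi))

⊆-∅ : ∀ {m} {X : Subset m} → X ⊆ ∅ → X ≐ ∅
⊆-∅ s = ⊆-antisym s (λ _ ())

⊆-full : ∀ {m} {X : Subset m} → X ⊆ full
⊆-full _ _ = refl

p⊆p∪q : ∀ {m} (X Y : Subset m) → X ⊆ (X ∪ Y)
p⊆p∪q X Y i h rewrite h = refl

q⊆p∪q : ∀ {m} (X Y : Subset m) → Y ⊆ (X ∪ Y)
q⊆p∪q X Y i h rewrite h = ∨-zeroʳ (X i)

x∈p∪q⁻ : ∀ {m} (X Y : Subset m) {i} → i ∈ X ∪ Y → i ∈ X ⊎ i ∈ Y
x∈p∪q⁻ X Y {i} h with X i
... | true  = inj₁ refl
... | false = inj₂ h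

∪-least : ∀ {m} {X Y Z : Subset m} → X ⊆ Z → Y ⊆ Z → (X ∪ Y) ⊆ Z
∪-least {X = X} {Y} a b i h with x∈p∪q⁻ X Y h
... | inj₁ p = a i p
... | inj₂ p = b i p

∪-cong : ∀ {m} {X X′ Y Y′ : Subset m} → X ≐ X′ → Y ≐ Y′ → X ∪ Y ≐ X′ ∪ Y′
∪-cong a b i = cong₂ _∨_ (a i) (b i)

∪-assoc : ∀ {m} (X Y Z : Subset m) → (X ∪ Y) ∪ Z ≐ X ∪ Y ∪ Z
∪-assoc X Y Z i = ∨-assoc (X i) (Y i) (Z i)

∪-comm : ∀ {m} (X Y : Subset m) → X ∪ Y ≐ Y ∪ X
∪-comm X Y i = ∨-comm (X i) (Y i)

∪-∅ʳ : ∀ {m} (X : Subset m) → X ∪ ∅ ≐ X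
∪-∅ʳ X i = ∨-identityʳ (X i)

∪-swapʳ : ∀ {m} (A B C : Subset m) → (A ∪ B) ∪ C ≐ (A ∪ C) ∪ B
∪-swapʳ A B C i = solve 3 (λ a b c → (a :+ b) :+ c := (a :+ c) :+ b) refl (A i) (B i) (C i)
  where open ∨-∧-Solver using (solve; _:=_; _:+_)

x∈⁅x⁆ : ∀ {m} (i : Fin m) → i ∈ ⁅ i ⁆
x∈⁅x⁆ i with i ≟ i
... | yes _ = refl
... | no i≢i = ⊥-elim (i≢i refl)

x∈⁅y⁆⇒x≡y : ∀ {m} {x y : Fin m} → x ∈ ⁅ y ⁆ → x ≡ y
x∈⁅y⁆⇒x≡y {x = x} {y} h with x ≟ y
... | yes p = p

x≢y⇒x∉⁅y⁆ : ∀ {m} {x y : Fin m} → x ≢ y → x ∉ ⁅ y ⁆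
x≢y⇒x∉⁅y⁆ {x = x} {y} x≢y with x ≟ y
... | yes p = ⊥-elim (x≢y p)
... | no _  = refl

x∈p⇒⁅x⁆⊆p : ∀ {m} {x : Fin m} {X} → x ∈ X → ⁅ x ⁆ ⊆ X
x∈p⇒⁅x⁆⊆p h j j∈⁅x⁆ rewrite x∈⁅y⁆⇒x≡y j∈⁅x⁆ = h

⊻-⊆ : ∀ {m} {X Y Z : Subset m} → X ⊆ Z → Y ⊆ Z → (X ⊻ Y) ⊆ Z
⊻-⊆ {X = X} {Y} a b i h with X i in xi | Y i in yi
... | true  | _    = a i xi
... | false | true = b i yi

p∩q⊆p : ∀ {m} (X Y : Subset m) → (X ∩ Y) ⊆ X
p∩q⊆p X Y i h with X i
... | true = refl

p∩q⊆q : ∀ {m} (X Y : Subset m) → (X ∩ Y) ⊆ Y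
p∩q⊆q X Y i h with X i
... | true = h

p⊆q∪r⇒p∖q⊆r : ∀ {m} {X Y Z : Subset m} → X ⊆ (Y ∪ Z) → (X ∖ Y) ⊆ Z
p⊆q∪r⇒p∖q⊆r {X = X} {Y} {Z} s i h with X i in xi | Y i in yi
... | true | false = subst (λ b → b ∨ Z i ≡ true) yi (s i xi)

split-∩∖ : ∀ {m} (X A : Subset m) → X ≐ (X ∩ A) ⊻ (X ∖ A)
split-∩∖ X A i with X i | A i
... | true  | true  = refl
... | true  | false = refl
... | false | _     = refl

⊆⁅⁆ : ∀ {m} {X : Subset m} {a} → X ⊆ ⁅ a ⁆ → X ≐ X a ·ₛ ⁅ a ⁆
⊆⁅⁆ {X = X} {a} s i with X i in xi
... | true  with refl ← x∈⁅y⁆⇒x≡y (s i xi) rewrite xi | x∈⁅x⁆ i = refl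
... | false with i ≟ a
...   | yes refl = sym (trans (∧-identityʳ _) xi)
...   | no  _    = sym (∧-zeroʳ (X a))

p∖q⊆p : ∀ {m} (X Y : Subset m) → (X ∖ Y) ⊆ X
p∖q⊆p X Y i h with X i
... | true = refl

p∖q-disjoint : ∀ {m} (X Y : Subset m) → Disjoint (X ∖ Y) Y
p∖q-disjoint X Y i h with X i | Y i
... | true | false = refl

∖∪-cancel : ∀ {m} {X Y : Subset m} → Y ⊆ X → (X ∖ Y) ∪ Y ≐ X
∖∪-cancel {X = X} {Y} Y⊆X i with Y i in yi
... | true  = trans (∨-zeroʳ _) (sym (Y⊆X i yi))
... | false = trans (∨-identityʳ _) (∧-identityʳ (X i))

x∈p∖⁅y⁆⇒x≢y : ∀ {m} {X : Subset m} {x y} → x ∈ X ∖ ⁅ y ⁆ → x ≢ y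
x∈p∖⁅y⁆⇒x≢y {X = X} {x} x∈ refl = ∉⇒¬∈ (p∖q-disjoint X ⁅ x ⁆ x x∈) (x∈⁅x⁆ x)

x∈p∖⁅y⁆ : ∀ {m} {X : Subset m} {x y} → x ∈ X → x ≢ y → x ∈ X ∖ ⁅ y ⁆
x∈p∖⁅y⁆ {X = X} {x} x∈X x≢y rewrite x∈X | x≢y⇒x∉⁅y⁆ x≢y = refl

∪-monoʳ : ∀ {m} (A : Subset m) {B B′} → B ⊆ B′ → (A ∪ B) ⊆ (A ∪ B′)
∪-monoʳ A {B} {B′} B⊆B′ = ∪-least (p⊆p∪q A B′) (⊆-trans B⊆B′ (q⊆p∪q A B′))

nonempty? : ∀ {m} (X : Subset m) → (∃ λ i → i ∈ X) ⊎ X ≐ ∅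
nonempty? X with any? (λ i → X i ≟ᵇ true)
... | yes p = inj₁ p
... | no ¬p = inj₂ λ i → ¬∈⇒∉ λ i∈X → ¬p (i , i∈X)

any-subset? : ∀ {m} {P : Subset m → Set} → (∀ {c d} → c ≐ d → P c → P d) → (∀ c → Dec (P c)) → Dec (∃ P)
any-subset? resp P? =
  map′ (λ (s , p) → lookup s , p) (λ (c , p) → tabulate c , resp (≐-sym (lookup∘tabulate c)) p)
       (anySubset? (P? ∘ lookup))

_⊆?_ : ∀ {m} (X Y : Subset m) → Dec (X ⊆ Y)
X ⊆? Y = all? λ i → (X i ≟ᵇ true) →-dec (Y i ≟ᵇ true)

module _ {m k : ℕ} (φ : Fin k → Fin m) where

  img⁻ : ∀ {X j} → j ∈ img φ X → ∃ λ i → i ∈ X × φ i ≡ j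
  img⁻ {X} {j} h =
    let i , Xi∧φi≟j = satisfied (any⁻ _ (allFin k) (from T-≡ h))
        Xi , φi≟j   = to T-∧ Xi∧φi≟j
    in i , to T-≡ Xi , toWitness φi≟j

  img⁺ : ∀ {X i j} → i ∈ X → φ i ≡ j → j ∈ img φ X
  img⁺ {X} {i} i∈X φi≡j =
    to T-≡ (any⁺ _ (lose (∈-allFin i)
      (from T-∧ (from T-≡ i∈X , fromWitness φi≡j))))

  img-∉ : ∀ {X j} → (∀ i → i ∈ X → φ i ≢ j) → j ∉ img φ X
  img-∉ h = ¬∈⇒∉ λ j∈ → let i , i∈X , φi≡j = img⁻ j∈ in h i i∈X φi≡j

  img-mono : ∀ {X Y} → X ⊆ Y → img φ X ⊆ img φ Y
  img-mono s j h = let i , i∈X , φi≡j = img⁻ h in img⁺ (s i i∈X) φi≡j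

  img-cong : ∀ {X Y} → X ≐ Y → img φ X ≐ img φ Y
  img-cong e = ⊆-antisym (img-mono (≐⇒⊆ e)) (img-mono (≐⇒⊆ (≐-sym e)))

  img-∪ : ∀ X Y → img φ (X ∪ Y) ≐ img φ X ∪ img φ Y
  img-∪ X Y = ⊆-antisym ⊆-part (∪-least (img-mono (p⊆p∪q X Y)) (img-mono (q⊆p∪q X Y)))
    where
    ⊆-part : img φ (X ∪ Y) ⊆ (img φ X ∪ img φ Y)
    ⊆-part j h with img⁻ h
    ... | i , i∈X∪Y , φi≡j with x∈p∪q⁻ X Y i∈X∪Y
    ...   | inj₁ i∈X = p⊆p∪q (img φ X) (img φ Y) j (img⁺ i∈X φi≡j)
    ...   | inj₂ i∈Y = q⊆p∪q (img φ X) (img φ Y) j (img⁺ i∈Y φi≡j)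

  img-⁅⁆ : ∀ i → img φ ⁅ i ⁆ ≐ ⁅ φ i ⁆
  img-⁅⁆ i = ⊆-antisym ⊆-part (λ j h → img⁺ (x∈⁅x⁆ i) (sym (x∈⁅y⁆⇒x≡y h)))
    where
    ⊆-part : img φ ⁅ i ⁆ ⊆ ⁅ φ i ⁆
    ⊆-part j h with img⁻ h
    ... | i′ , i′∈⁅i⁆ , refl rewrite x∈⁅y⁆⇒x≡y i′∈⁅i⁆ = x∈⁅x⁆ (φ i)

  img-∅ : ∀ {X} → X ≐ ∅ → img φ X ≐ ∅
  img-∅ {X} e j = img-∉ (λ i i∈X _ → ∉⇒¬∈ (e i) i∈X)

  img-preimage : ∀ I → I ⊆ img φ full → img φ (I ∘ φ) ≐ I
  img-preimage I s = ⊆-antisym ⊆-part ⊇-part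
    where
    ⊆-part : img φ (I ∘ φ) ⊆ I
    ⊆-part j h with img⁻ h
    ... | i , Iφi , refl = Iφi
    ⊇-part : I ⊆ img φ (I ∘ φ)
    ⊇-part j h with img⁻ (s j h)
    ... | i , _ , refl = img⁺ h refl

img-∘ : ∀ {m k l} (φ : Fin k → Fin m) (ψ : Fin l → Fin k) X → img φ (img ψ X) ≐ img (φ ∘ ψ) X
img-∘ φ ψ X = ⊆-antisym ⊆-part ⊇-part
  where
  ⊆-part : img φ (img ψ X) ⊆ img (φ ∘ ψ) X
  ⊆-part j h with img⁻ φ h
  ... | i , i∈ψX , φi≡j with img⁻ ψ i∈ψX
  ...   | l , l∈X , refl = img⁺ (φ ∘ ψ) l∈X φi≡j
  ⊇-part : img (φ ∘ ψ) X ⊆ img φ (img ψ X)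
  ⊇-part j h with img⁻ (φ ∘ ψ) h
  ... | l , l∈X , φψl≡j = img⁺ φ (img⁺ ψ l∈X refl) φψl≡j

img-∘-full : ∀ {m k l} (φ : Fin k → Fin m) (ψ : Fin l → Fin k) → img (φ ∘ ψ) full ⊆ img φ full
img-∘-full φ ψ j h = let i , _ , φψi≡j = img⁻ (φ ∘ ψ) h in img⁺ φ refl φψi≡j

img-id : ∀ {m} (X : Subset m) → img id X ≐ X
img-id X = ⊆-antisym (λ j h → let i , i∈X , i≡j = img⁻ id h in subst (_∈ X) i≡j i∈X) (λ j h → img⁺ id {X} h refl)

img-restrict : ∀ {m k} (φ : Fin k → Fin m) {S : Subset k} {X : Subset m} → X ⊆ img φ S → img φ (S ∩ (X ∘ φ)) ≐ X
img-restrict φ {S} {X} X⊆φS = ⊆-antisym ⊆-part ⊇-part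
  where
  ⊆-part : img φ (S ∩ (X ∘ φ)) ⊆ X
  ⊆-part j h with img⁻ φ h
  ... | i , i∈ , refl = p∩q⊆q S (X ∘ φ) i i∈
  ⊇-part : X ⊆ img φ (S ∩ (X ∘ φ))
  ⊇-part j j∈X with img⁻ φ (X⊆φS j j∈X)
  ... | i , i∈S , refl = img⁺ φ {S ∩ (X ∘ φ)} (subst (λ b → b ∧ X (φ i) ≡ true) (sym i∈S) j∈X) refl

infixr 30 _·_

_·_ : ∀ {n} → Bool → Vec Bool n → Vec Bool n
true  · u = u
false · u = zeroV

·-xor : ∀ {n} a b (u : Vec Bool n) → (a xor b) · u ≡ a · u ⊕ b · u
·-xor true  true  u = sym (⊕-self u)
·-xor true  false u = sym (⊕-identityʳ u)
·-xor false b     u = sym (⊕-identityˡ (b · u))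

·-zeroV : ∀ {n} b → b · zeroV {n} ≡ zeroV
·-zeroV true  = refl
·-zeroV false = refl

lincomb-suc : ∀ {m n} (v : Fin (suc m) → Vec Bool n) (c : Subset (suc m)) →
              lincomb v c ≡ c zero · v zero ⊕ lincomb (v ∘ suc) (c ∘ suc)
lincomb-suc v c with c zero
... | true  = refl
... | false = sym (⊕-identityˡ _)

lincomb-cong : ∀ {m n} (v : Fin m → Vec Bool n) {c d : Subset m} → c ≐ d → lincomb v c ≡ lincomb v d
lincomb-cong {zero}  v e = refl
lincomb-cong {suc m} v {c} {d} e
  rewrite lincomb-suc v c | lincomb-suc v d | e zero | lincomb-cong (v ∘ suc) (e ∘ suc) = refl

lincomb-cong-on : ∀ {m n} {v w : Fin m → Vec Bool n} (c : Subset m) → (∀ i → i ∈ c → v i ≡ w i) →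
                  lincomb v c ≡ lincomb w c
lincomb-cong-on {zero}  c e = refl
lincomb-cong-on {suc m} {v = v} {w} c e
  rewrite lincomb-suc v c | lincomb-suc w c | lincomb-cong-on {v = v ∘ suc} {w ∘ suc} (c ∘ suc) (e ∘ suc) =
  cong (_⊕ lincomb (w ∘ suc) (c ∘ suc)) (head-term (c zero) refl)
  where
  head-term : ∀ b → c zero ≡ b → b · v zero ≡ b · w zero
  head-term true  c0 = e zero c0
  head-term false _  = refl

lincomb-∅ : ∀ {m n} (v : Fin m → Vec Bool n) {c : Subset m} → c ≐ ∅ → lincomb v c ≡ zeroV
lincomb-∅ {zero}  v e = refl
lincomb-∅ {suc m} v {c} e
  rewrite lincomb-suc v c | e zero | lincomb-∅ (v ∘ suc) (e ∘ suc) = ⊕-identityˡ zeroV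

lincomb-0 : ∀ {m n} (c : Subset m) → lincomb (λ _ → zeroV {n}) c ≡ zeroV
lincomb-0 {zero}  c = refl
lincomb-0 {suc m} {n} c =
  trans (lincomb-suc (λ _ → zeroV) c) (trans (cong₂ _⊕_ (·-zeroV (c zero)) (lincomb-0 (c ∘ suc))) (⊕-identityˡ zeroV))

lincomb-⊻ : ∀ {m n} (v : Fin m → Vec Bool n) (c d : Subset m) →
            lincomb v (c ⊻ d) ≡ lincomb v c ⊕ lincomb v d
lincomb-⊻ {zero}  v c d = sym (⊕-identityˡ zeroV)
lincomb-⊻ {suc m} v c d
  rewrite lincomb-suc v (c ⊻ d) | lincomb-suc v c | lincomb-suc v d
        | lincomb-⊻ (v ∘ suc) (c ∘ suc) (d ∘ suc) | ·-xor (c zero) (d zero) (v zero) =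
  ⊕-interchange (c zero · v zero) (d zero · v zero) _ _

lincomb-·ₛ : ∀ {m n} (v : Fin m → Vec Bool n) b X → lincomb v (b ·ₛ X) ≡ b · lincomb v X
lincomb-·ₛ v true  X = refl
lincomb-·ₛ v false X = lincomb-∅ v (λ _ → refl)

⁅suc⁆∘suc : ∀ {m} (i : Fin m) → ⁅ suc i ⁆ ∘ suc ≐ ⁅ i ⁆
⁅suc⁆∘suc i j with j ≟ i
... | yes _ = refl
... | no _  = refl

lincomb-⁅⁆ : ∀ {m n} (v : Fin m → Vec Bool n) i → lincomb v ⁅ i ⁆ ≡ v i
lincomb-⁅⁆ v zero
  rewrite lincomb-suc v ⁅ zero ⁆ | lincomb-∅ (v ∘ suc) {⁅ zero ⁆ ∘ suc} (λ _ → refl) = ⊕-identityʳ (v zero)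
lincomb-⁅⁆ v (suc i)
  rewrite lincomb-suc v ⁅ suc i ⁆ | lincomb-cong (v ∘ suc) (⁅suc⁆∘suc i)
        | lincomb-⁅⁆ (v ∘ suc) i = ⊕-identityˡ (v (suc i))

lincomb-map : ∀ {m n n′} (π : Vec Bool n → Vec Bool n′) → (∀ u w → π (u ⊕ w) ≡ π u ⊕ π w) → π zeroV ≡ zeroV →
              (v : Fin m → Vec Bool n) (c : Subset m) → lincomb (π ∘ v) c ≡ π (lincomb v c)
lincomb-map {zero}  π π-⊕ π-0 v c = sym π-0
lincomb-map {suc m} π π-⊕ π-0 v c
  rewrite lincomb-suc (π ∘ v) c | lincomb-suc v c | π-⊕ (c zero · v zero) (lincomb (v ∘ suc) (c ∘ suc))
        | lincomb-map π π-⊕ π-0 (v ∘ suc) (c ∘ suc) = cong (_⊕ _) (π-· (c zero))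
  where
  π-· : ∀ b → b · π (v zero) ≡ π (b · v zero)
  π-· true  = refl
  π-· false = sym π-0

InjectiveOn : ∀ {m k} → (Fin k → Fin m) → Subset k → Set
InjectiveOn φ c = ∀ {i j} → i ∈ c → j ∈ c → φ i ≡ φ j → i ≡ j

img-suc : ∀ {m k} (φ : Fin (suc k) → Fin m) (c : Subset (suc k)) j →
          img φ c j ≡ (c zero ∧ ⌊ φ zero ≟ j ⌋) ∨ img (φ ∘ suc) (c ∘ suc) j
img-suc {k = k} φ c j = cong (λ bs → (c zero ∧ ⌊ φ zero ≟ j ⌋) ∨ or bs)
  (trans (map-tabulate suc (λ i → c i ∧ ⌊ φ i ≟ j ⌋)) (sym (map-tabulate id (λ i → c (suc i) ∧ ⌊ φ (suc i) ≟ j ⌋))))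

img-suc-⊻ : ∀ {m k} (φ : Fin (suc k) → Fin m) (c : Subset (suc k)) → InjectiveOn φ c →
            img φ c ≐ (c zero ·ₛ ⁅ φ zero ⁆) ⊻ img (φ ∘ suc) (c ∘ suc)
img-suc-⊻ {k = k} φ c inj j rewrite img-suc φ c j with c zero in c0 | φ zero ≟ j
... | false | _      = refl
... | true  | no  φ0≢j rewrite x≢y⇒x∉⁅y⁆ {x = j} (φ0≢j ∘ sym) = refl
... | true  | yes refl rewrite x∈⁅x⁆ (φ zero)
                             | img-∉ (φ ∘ suc) {c ∘ suc} λ i ci φ0≡φi → 0≢1+n (inj c0 ci (sym φ0≡φi)) = refl

lincomb-img : ∀ {m k n} (v : Fin m → Vec Bool n) (φ : Fin k → Fin m) (c : Subset k) → InjectiveOn φ c →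
              lincomb v (img φ c) ≡ lincomb (v ∘ φ) c
lincomb-img {k = zero}  v φ c inj = lincomb-∅ v (λ _ → refl)
lincomb-img {k = suc k} v φ c inj = begin
  lincomb v (img φ c)
    ≡⟨ lincomb-cong v (img-suc-⊻ φ c inj) ⟩
  lincomb v ((c zero ·ₛ ⁅ φ zero ⁆) ⊻ img (φ ∘ suc) (c ∘ suc))
    ≡⟨ lincomb-⊻ v _ _ ⟩
  lincomb v (c zero ·ₛ ⁅ φ zero ⁆) ⊕ lincomb v (img (φ ∘ suc) (c ∘ suc))
    ≡⟨ cong₂ _⊕_ (trans (lincomb-·ₛ v (c zero) ⁅ φ zero ⁆) (cong (c zero ·_) (lincomb-⁅⁆ v (φ zero))))
                 (lincomb-img v (φ ∘ suc) (c ∘ suc) (λ ci cj → suc-injective ∘ inj ci cj)) ⟩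
  c zero · v (φ zero) ⊕ lincomb (v ∘ φ ∘ suc) (c ∘ suc)
    ≡⟨ lincomb-suc (v ∘ φ) c ⟨
  lincomb (v ∘ φ) c ∎
  where open ≡-Reasoning

lincomb-⁅⁆⊻ : ∀ {m n} (vs : Fin m → Vec Bool n) k b → lincomb vs (⁅ k ⁆ ⊻ b) ≡ vs k ⊕ lincomb vs b
lincomb-⁅⁆⊻ vs k b = trans (lincomb-⊻ vs ⁅ k ⁆ b) (cong (_⊕ lincomb vs b) (lincomb-⁅⁆ vs k))

lincomb-pair : ∀ {m n} (vs : Fin m → Vec Bool n) i j → lincomb vs (⁅ i ⁆ ⊻ ⁅ j ⁆) ≡ vs i ⊕ vs j
lincomb-pair vs i j = trans (lincomb-⁅⁆⊻ vs i ⁅ j ⁆) (cong (vs i ⊕_) (lincomb-⁅⁆ vs j))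

lincomb-pair⊻ : ∀ {m n} (vs : Fin m → Vec Bool n) i j b →
                lincomb vs ((⁅ i ⁆ ⊻ ⁅ j ⁆) ⊻ b) ≡ (vs i ⊕ vs j) ⊕ lincomb vs b
lincomb-pair⊻ vs i j b = trans (lincomb-⊻ vs (⁅ i ⁆ ⊻ ⁅ j ⁆) b) (cong (_⊕ lincomb vs b) (lincomb-pair vs i j))

-- Linear (in)dependence and spans over GF(2)

module _ {m n : ℕ} (vs : Fin m → Vec Bool n) where

  Independent : Subset m → Set
  Independent X = ∀ (c : Subset m) → c ⊆ X → lincomb vs c ≡ zeroV → ∀ i → c i ≡ false

  record Dependent (X : Subset m) : Set where
    constructor dependency
    field
      support  : Subset m
      support⊆ : support ⊆ X
      sum≡0    : lincomb vs support ≡ zeroV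
      nonempty : ∃ λ i → i ∈ support

  record Span (S : Subset m) (w : Vec Bool n) : Set where
    constructor spanned-by
    field
      coeffs  : Subset m
      coeffs⊆ : coeffs ⊆ S
      sum≡    : lincomb vs coeffs ≡ w

  IndependentMod : Subset m → Subset m → Set
  IndependentMod B A = ∀ a → a ⊆ A → Span B (lincomb vs a) → a ≐ ∅

Dep : (M : SBM) → Subset (m M) → Set
Dep M = Dependent (vec M)

module _ {m n : ℕ} {vs : Fin m → Vec Bool n} where

  Dep⇒¬Indep : ∀ {X} → Dependent vs X → ¬ Independent vs X
  Dep⇒¬Indep (dependency c c⊆X Σc≡0 (i , i∈c)) ind = ∉⇒¬∈ (ind c c⊆X Σc≡0 i) i∈c

  ¬Dep⇒Indep : ∀ {X} → ¬ Dependent vs X → Independent vs X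
  ¬Dep⇒Indep ¬dep c c⊆X Σc≡0 i = ¬∈⇒∉ λ i∈c → ¬dep (dependency c c⊆X Σc≡0 (i , i∈c))

  Dep-mono : ∀ {X Y} → X ⊆ Y → Dependent vs X → Dependent vs Y
  Dep-mono X⊆Y (dependency c c⊆X Σc≡0 ne) = dependency c (⊆-trans c⊆X X⊆Y) Σc≡0 ne

  Dep-cong : ∀ {X Y} → X ≐ Y → Dependent vs X → Dependent vs Y
  Dep-cong = Dep-mono ∘ ≐⇒⊆

  span-mono : ∀ {S T w} → S ⊆ T → Span vs S w → Span vs T w
  span-mono S⊆T (spanned-by d d⊆S Σd≡w) = spanned-by d (⊆-trans d⊆S S⊆T) Σd≡w

  span-0 : ∀ {S} → Span vs S zeroV
  span-0 = spanned-by ∅ (λ _ ()) (lincomb-∅ vs (λ _ → refl))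

  span-∈ : ∀ {S i} → i ∈ S → Span vs S (vs i)
  span-∈ {i = i} i∈S = spanned-by ⁅ i ⁆ (x∈p⇒⁅x⁆⊆p i∈S) (lincomb-⁅⁆ vs i)

  span-⊕ : ∀ {S u w} → Span vs S u → Span vs S w → Span vs S (u ⊕ w)
  span-⊕ (spanned-by c c⊆S Σc≡u) (spanned-by d d⊆S Σd≡w) =
    spanned-by (c ⊻ d) (⊻-⊆ c⊆S d⊆S) (trans (lincomb-⊻ vs c d) (cong₂ _⊕_ Σc≡u Σd≡w))

  span-· : ∀ {S u} b → Span vs S u → Span vs S (b · u)
  span-· true  sp = sp
  span-· false _  = span-0

lincomb-split : ∀ {m n} (vs : Fin m → Vec Bool n) (c A : Subset m) →
                lincomb vs c ≡ lincomb vs (c ∩ A) ⊕ lincomb vs (c ∖ A)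
lincomb-split vs c A = trans (lincomb-cong vs (split-∩∖ c A)) (lincomb-⊻ vs _ _)

lincomb-⊆⁅⁆ : ∀ {m n} (vs : Fin m → Vec Bool n) {c a} → c ⊆ ⁅ a ⁆ → lincomb vs c ≡ c a · vs a
lincomb-⊆⁅⁆ vs {c} {a} c⊆a =
  trans (lincomb-cong vs (⊆⁅⁆ c⊆a)) (trans (lincomb-·ₛ vs (c a) ⁅ a ⁆) (cong (c a ·_) (lincomb-⁅⁆ vs a)))

module _ {m n : ℕ} (vs : Fin m → Vec Bool n) where

  dependent? : ∀ X → Dec (Dependent vs X)
  dependent? X =
    map′ (λ (c , c⊆X , Σc≡0 , ne) → dependency c c⊆X Σc≡0 ne) (λ (dependency c c⊆X Σc≡0 ne) → c , c⊆X , Σc≡0 , ne)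
      (any-subset? respects λ c → (c ⊆? X) ×-dec (lincomb vs c ≟ᵛ zeroV) ×-dec any? (λ i → c i ≟ᵇ true))
    where
    respects : ∀ {c d} → c ≐ d → c ⊆ X × lincomb vs c ≡ zeroV × (∃ λ i → i ∈ c) →
                                 d ⊆ X × lincomb vs d ≡ zeroV × (∃ λ i → i ∈ d)
    respects c≐d (c⊆X , Σc≡0 , i , i∈c) =
      ⊆-trans (≐⇒⊆ (≐-sym c≐d)) c⊆X , trans (sym (lincomb-cong vs c≐d)) Σc≡0 , i , trans (sym (c≐d i)) i∈c

  independent? : ∀ X → Dec (Independent vs X)
  independent? X with dependent? X
  ... | yes dep = no (Dep⇒¬Indep dep)
  ... | no ¬dep = yes (¬Dep⇒Indep ¬dep)

  ¬Indep⇒Dep : ∀ {X} → ¬ Independent vs X → Dependent vs X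
  ¬Indep⇒Dep {X} ¬ind with dependent? X
  ... | yes dep = dep
  ... | no ¬dep = ⊥-elim (¬ind (¬Dep⇒Indep ¬dep))

  span? : ∀ S w → Dec (Span vs S w)
  span? S w =
    map′ (λ (d , d⊆S , Σd≡w) → spanned-by d d⊆S Σd≡w) (λ (spanned-by d d⊆S Σd≡w) → d , d⊆S , Σd≡w)
      (any-subset? respects λ d → (d ⊆? S) ×-dec (lincomb vs d ≟ᵛ w))
    where
    respects : ∀ {c d} → c ≐ d → c ⊆ S × lincomb vs c ≡ w → d ⊆ S × lincomb vs d ≡ w
    respects c≐d (c⊆S , Σc≡w) = ⊆-trans (≐⇒⊆ (≐-sym c≐d)) c⊆S , trans (sym (lincomb-cong vs c≐d)) Σc≡w

  Indep-∅ : Independent vs ∅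
  Indep-∅ c c⊆∅ _ i = ¬∈⇒∉ λ i∈c → ∉⇒¬∈ refl (c⊆∅ i i∈c)

  Indep-mono : ∀ {X Y} → X ⊆ Y → Independent vs Y → Independent vs X
  Indep-mono X⊆Y ind c c⊆X = ind c (⊆-trans c⊆X X⊆Y)

  Indep-cong : ∀ {X Y} → X ≐ Y → Independent vs X → Independent vs Y
  Indep-cong X≐Y = Indep-mono (≐⇒⊆ (≐-sym X≐Y))

  span-∪⁻ : ∀ {A B w} → Span vs (A ∪ B) w → ∃ λ a → a ⊆ A × Span vs B (lincomb vs a ⊕ w)
  span-∪⁻ {A} {B} {w} (spanned-by d d⊆A∪B Σd≡w) =
    d ∩ A , p∩q⊆q d A , spanned-by (d ∖ A) (p⊆q∪r⇒p∖q⊆r d⊆A∪B) (begin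
      lincomb vs (d ∖ A)                                          ≡⟨ ⊕-cancelˡ (lincomb vs (d ∩ A)) _ ⟨
      lincomb vs (d ∩ A) ⊕ (lincomb vs (d ∩ A) ⊕ lincomb vs (d ∖ A)) ≡⟨ cong (lincomb vs (d ∩ A) ⊕_) (lincomb-split vs d A) ⟨
      lincomb vs (d ∩ A) ⊕ lincomb vs d                            ≡⟨ cong (lincomb vs (d ∩ A) ⊕_) Σd≡w ⟩
      lincomb vs (d ∩ A) ⊕ w                                       ∎)
    where open ≡-Reasoning

  span-∪⁅⁆⁻ : ∀ {S a w} → Span vs (S ∪ ⁅ a ⁆) w → Span vs S w ⊎ Span vs S (w ⊕ vs a)
  span-∪⁅⁆⁻ {S} {a} {w} sp with span-∪⁻ (span-mono (≐⇒⊆ (∪-comm S ⁅ a ⁆)) sp)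
  ... | c , c⊆a , spc = by-coefficient (c a) refl
    where
    Σc≡ : ∀ {b} → c a ≡ b → lincomb vs c ⊕ w ≡ b · vs a ⊕ w
    Σc≡ ca = cong (_⊕ w) (trans (lincomb-⊆⁅⁆ vs c⊆a) (cong (_· vs a) ca))
    by-coefficient : ∀ b → c a ≡ b → Span vs S w ⊎ Span vs S (w ⊕ vs a)
    by-coefficient false ca = inj₁ (subst (Span vs S) (trans (Σc≡ ca) (⊕-identityˡ w)) spc)
    by-coefficient true  ca = inj₂ (subst (Span vs S) (trans (Σc≡ ca) (⊕-comm (vs a) w)) spc)

  span-∩ : ∀ {A B c} → c ⊆ (A ∪ B) → lincomb vs c ≡ zeroV → Span vs B (lincomb vs (c ∩ A))
  span-∩ {A} {B} {c} c⊆A∪B Σc≡0 =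
    subst (Span vs B) (trans (cong (lincomb vs (c ∩ A) ⊕_) Σc≡0) (⊕-identityʳ _))
      (proj₂ (proj₂ (span-∪⁻ {A} (spanned-by c c⊆A∪B refl))))

  sum-∖ : ∀ c {A} → lincomb vs c ≡ zeroV → c ∩ A ≐ ∅ → lincomb vs (c ∖ A) ≡ zeroV
  sum-∖ c {A} Σc≡0 c∩A≡∅ = begin
    lincomb vs (c ∖ A)                          ≡⟨ ⊕-identityˡ _ ⟨
    zeroV ⊕ lincomb vs (c ∖ A)                  ≡⟨ cong (_⊕ lincomb vs (c ∖ A)) (lincomb-∅ vs c∩A≡∅) ⟨
    lincomb vs (c ∩ A) ⊕ lincomb vs (c ∖ A)     ≡⟨ lincomb-split vs c A ⟨
    lincomb vs c                                ≡⟨ Σc≡0 ⟩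
    zeroV                                       ∎
    where open ≡-Reasoning

  Indep-∪⇒IndependentMod : ∀ {A B} → Independent vs (A ∪ B) → Disjoint A B → IndependentMod vs B A
  Indep-∪⇒IndependentMod {A} {B} ind A∩B≡∅ a a⊆A (spanned-by d d⊆B Σd≡Σa) i = ¬∈⇒∉ λ i∈a →
    ∉⇒¬∈ (ind (a ⊻ d) (⊻-⊆ (⊆-trans a⊆A (p⊆p∪q A B)) (⊆-trans d⊆B (q⊆p∪q A B)))
               (trans (lincomb-⊻ vs a d) (trans (cong (_ ⊕_) Σd≡Σa) (⊕-self _))) i)
         (subst (λ b → b xor d i ≡ true) (sym i∈a) (cong not (¬∈⇒∉ (∉⇒¬∈ (A∩B≡∅ i (a⊆A i i∈a)) ∘ d⊆B i))))

  IndependentMod⇒Indep-∪ : ∀ {A B} → Independent vs B → IndependentMod vs B A → Independent vs (A ∪ B)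
  IndependentMod⇒Indep-∪ {A} {B} indB modA c c⊆A∪B Σc≡0 i =
    trans (split-∩∖ c A i) (cong₂ _xor_ (c∩A≡∅ i) (indB (c ∖ A) (p⊆q∪r⇒p∖q⊆r c⊆A∪B) Σc∖A≡0 i))
    where
    c∩A≡∅ : c ∩ A ≐ ∅
    c∩A≡∅ = modA (c ∩ A) (p∩q⊆q c A) (span-∩ c⊆A∪B Σc≡0)
    Σc∖A≡0 : lincomb vs (c ∖ A) ≡ zeroV
    Σc∖A≡0 = sum-∖ c Σc≡0 c∩A≡∅

  Dep-∪⇒Span : ∀ {A B} → Independent vs B → Dependent vs (A ∪ B) →
               ∃ λ a → a ⊆ A × (∃ λ i → i ∈ a) × Span vs B (lincomb vs a)
  Dep-∪⇒Span {A} {B} indB (dependency c c⊆A∪B Σc≡0 (i , i∈c)) with nonempty? (c ∩ A)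
  ... | inj₁ c∩A≢∅ = c ∩ A , p∩q⊆q c A , c∩A≢∅ , span-∩ c⊆A∪B Σc≡0
  ... | inj₂ c∩A≡∅ = ⊥-elim (∉⇒¬∈ c∌i i∈c)
    where
    c∌i : c i ≡ false
    c∌i = trans (split-∩∖ c A i)
                (cong₂ _xor_ (c∩A≡∅ i) (indB (c ∖ A) (p⊆q∪r⇒p∖q⊆r c⊆A∪B) (sum-∖ c Σc≡0 c∩A≡∅) i))

  -- the matroid closure; it agrees with the span of S only when S is independent
  InClosure : Subset m → Fin m → Set
  InClosure S f = f ∈ S ⊎ Dependent vs (S ∪ ⁅ f ⁆)

  Span⇒InClosure : ∀ {S f} → Span vs S (vs f) → InClosure S f
  Span⇒InClosure {S} {f} (spanned-by d d⊆S Σd≡vf) with S f in Sf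
  ... | true  = inj₁ refl
  ... | false = inj₂ (dependency (d ⊻ ⁅ f ⁆) (⊻-⊆ (⊆-trans d⊆S (p⊆p∪q S ⁅ f ⁆)) (q⊆p∪q S ⁅ f ⁆))
                  (trans (lincomb-⊻ vs d ⁅ f ⁆) (trans (cong₂ _⊕_ Σd≡vf (lincomb-⁅⁆ vs f)) (⊕-self (vs f))))
                  (f , f∈d⊻f))
    where
    f∈d⊻f : (d ⊻ ⁅ f ⁆) f ≡ true
    f∈d⊻f rewrite ¬∈⇒∉ (∉⇒¬∈ Sf ∘ d⊆S f) | x∈⁅x⁆ f = refl

  InClosure⇒Span : ∀ {S f} → Independent vs S → InClosure S f → Span vs S (vs f)
  InClosure⇒Span indS (inj₁ f∈S) = span-∈ f∈S
  InClosure⇒Span {S} {f} indS (inj₂ dep) with Dep-∪⇒Span indS (Dep-cong (∪-comm S ⁅ f ⁆) dep)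
  ... | a , a⊆f , (i , i∈a) , spa = subst (Span vs S) Σa≡vf spa
    where
    Σa≡vf : lincomb vs a ≡ vs f
    Σa≡vf with refl ← x∈⁅y⁆⇒x≡y (a⊆f i i∈a) = trans (lincomb-⊆⁅⁆ vs a⊆f) (cong (_· vs i) i∈a)

  InClosure-parallel : ∀ {S e f g} → Independent vs S → e ∈ S → vs f ⊕ vs g ≡ vs e →
                       InClosure S g → InClosure S f
  InClosure-parallel {S} {e} {f} {g} indS e∈S vf⊕vg≡ve clg =
    Span⇒InClosure (subst (Span vs S) vg⊕ve≡vf (span-⊕ (InClosure⇒Span indS clg) (span-∈ e∈S)))
    where
    vg⊕ve≡vf : vs g ⊕ vs e ≡ vs f
    vg⊕ve≡vf = trans (cong (vs g ⊕_) (sym vf⊕vg≡ve)) (trans (cong (vs g ⊕_) (⊕-comm (vs f) (vs g))) (⊕-cancelˡ (vs g) (vs f)))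

  span-⁅⁆ : ∀ {g w} → Span vs ⁅ g ⁆ w → w ≡ zeroV ⊎ w ≡ vs g
  span-⁅⁆ {g} (spanned-by d d⊆g Σd≡w) with d g in dg
  ... | false = inj₁ (trans (sym Σd≡w) (trans (lincomb-⊆⁅⁆ vs d⊆g) (cong (_· vs g) dg)))
  ... | true  = inj₂ (trans (sym Σd≡w) (trans (lincomb-⊆⁅⁆ vs d⊆g) (cong (_· vs g) dg)))

  Indep-⁅⁆ : ∀ {a} → vs a ≢ zeroV → Independent vs ⁅ a ⁆
  Indep-⁅⁆ {a} va≢0 c c⊆a Σc≡0 i with c a in ca
  ... | true  = ⊥-elim (va≢0 (trans (sym (cong (_· vs a) ca)) (trans (sym (lincomb-⊆⁅⁆ vs c⊆a)) Σc≡0)))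
  ... | false = trans (⊆⁅⁆ c⊆a i) (cong (_∧ ⁅ a ⁆ i) ca)

  Indep-pair : ∀ {a b} → vs a ≢ zeroV → vs b ≢ zeroV → vs a ≢ vs b → Independent vs (⁅ a ⁆ ∪ ⁅ b ⁆)
  Indep-pair {a} {b} va≢0 vb≢0 va≢vb = IndependentMod⇒Indep-∪ (Indep-⁅⁆ vb≢0) mod
    where
    mod : IndependentMod vs ⁅ b ⁆ ⁅ a ⁆
    mod c c⊆a spc i with c a in ca
    ... | false = trans (⊆⁅⁆ c⊆a i) (cong (_∧ ⁅ a ⁆ i) ca)
    ... | true with span-⁅⁆ (subst (Span vs ⁅ b ⁆) (trans (lincomb-⊆⁅⁆ vs c⊆a) (cong (_· vs a) ca)) spc)
    ...   | inj₁ va≡0  = ⊥-elim (va≢0 va≡0)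
    ...   | inj₂ va≡vb = ⊥-elim (va≢vb va≡vb)

  sum⇒Dep-triple : ∀ {f g e} → vs f ⊕ vs g ≡ vs e → f ≢ g → f ≢ e → Dependent vs (⁅ f ⁆ ∪ ⁅ g ⁆ ∪ ⁅ e ⁆)
  sum⇒Dep-triple {f} {g} {e} vf⊕vg≡ve f≢g f≢e =
    dependency (⁅ f ⁆ ⊻ ⁅ g ⁆ ⊻ ⁅ e ⁆)
      (⊻-⊆ (p⊆p∪q ⁅ f ⁆ _) (⊻-⊆ (⊆-trans (p⊆p∪q ⁅ g ⁆ ⁅ e ⁆) (q⊆p∪q ⁅ f ⁆ _))
                                (⊆-trans (q⊆p∪q ⁅ g ⁆ ⁅ e ⁆) (q⊆p∪q ⁅ f ⁆ _))))
      sum (f , f∈)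
    where
    sum : lincomb vs (⁅ f ⁆ ⊻ ⁅ g ⁆ ⊻ ⁅ e ⁆) ≡ zeroV
    sum rewrite lincomb-⊻ vs ⁅ f ⁆ (⁅ g ⁆ ⊻ ⁅ e ⁆) | lincomb-⊻ vs ⁅ g ⁆ ⁅ e ⁆
              | lincomb-⁅⁆ vs f | lincomb-⁅⁆ vs g | lincomb-⁅⁆ vs e
              = trans (sym (⊕-assoc (vs f) (vs g) (vs e))) (trans (cong (_⊕ vs e) vf⊕vg≡ve) (⊕-self (vs e)))
    f∈ : (⁅ f ⁆ ⊻ ⁅ g ⁆ ⊻ ⁅ e ⁆) f ≡ true
    f∈ rewrite x∈⁅x⁆ f | x≢y⇒x∉⁅y⁆ f≢g | x≢y⇒x∉⁅y⁆ f≢e = refl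

single-indep : (M : SBM) (a : Fin (m M)) → Indep M ⁅ a ⁆
single-indep M a = Indep-⁅⁆ (vec M) (nonzero M a)

pair-indep : (M : SBM) {a b : Fin (m M)} → a ≢ b → Indep M (⁅ a ⁆ ∪ ⁅ b ⁆)
pair-indep M {a} {b} a≢b = Indep-pair (vec M) (nonzero M a) (nonzero M b) (a≢b ∘ distinct M)

Dep-triple⇒sum : (M : SBM) {f g e : Fin (m M)} → Dep M (⁅ f ⁆ ∪ ⁅ g ⁆ ∪ ⁅ e ⁆) → f ≢ g → f ≢ e → g ≢ e →
                 vec M f ⊕ vec M g ≡ vec M e
Dep-triple⇒sum M {f} {g} {e} dep f≢g f≢e g≢e =
  [ in-span-g , in-span-g⊕e ]′
    (span-∪⁅⁆⁻ (vec M) (InClosure⇒Span (vec M) (pair-indep M g≢e) (inj₂ (Dep-cong (∪-comm ⁅ f ⁆ _) dep))))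
  where
  in-span-g : Span (vec M) ⁅ g ⁆ (vec M f) → vec M f ⊕ vec M g ≡ vec M e
  in-span-g sp with span-⁅⁆ (vec M) sp
  ... | inj₁ vf≡0  = ⊥-elim (nonzero M f vf≡0)
  ... | inj₂ vf≡vg = ⊥-elim (f≢g (distinct M vf≡vg))
  in-span-g⊕e : Span (vec M) ⁅ g ⁆ (vec M f ⊕ vec M e) → vec M f ⊕ vec M g ≡ vec M e
  in-span-g⊕e sp with span-⁅⁆ (vec M) sp
  ... | inj₁ vf⊕ve≡0  = ⊥-elim (f≢e (distinct M (⊕≡0⇒≡ vf⊕ve≡0)))
  ... | inj₂ vf⊕ve≡vg = trans (cong (vec M f ⊕_) (sym vf⊕ve≡vg)) (⊕-cancelˡ (vec M f) (vec M e))

span-img-∪⁻ : ∀ {k m n} (vs : Fin m → Vec Bool n) {ψ : Fin k → Fin m} {C w} → Injective _≡_ _≡_ ψ →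
              Span vs (img ψ full ∪ C) w → ∃ λ b → Span vs C (lincomb (vs ∘ ψ) b ⊕ w)
span-img-∪⁻ vs {ψ} {C} {w} ψ-injective sp with span-∪⁻ vs {img ψ full} sp
... | a , a⊆ψ , spa = a ∘ ψ , subst (Span vs C) (cong (_⊕ w) Σa≡) spa
  where
  Σa≡ : lincomb vs a ≡ lincomb (vs ∘ ψ) (a ∘ ψ)
  Σa≡ = trans (sym (lincomb-cong vs (img-preimage ψ a a⊆ψ))) (lincomb-img vs ψ (a ∘ ψ) λ _ _ → ψ-injective)

sum⇒Triangle : (M : SBM) {i j k : Fin (m M)} → vec M i ⊕ vec M j ≡ vec M k → i ≢ j → i ≢ k → j ≢ k → Triangle M i j k
sum⇒Triangle M sum i≢j i≢k j≢k =
  i≢j , i≢k , j≢k , Dep⇒¬Indep (sum⇒Dep-triple (vec M) sum i≢j i≢k) , pair-indep M i≢j , pair-indep M i≢k , pair-indep M j≢k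

Indep-⇔ : (M : SBM) {X Y : Subset (m M)} → X ≐ Y → Indep M X ⇔ Indep M Y
Indep-⇔ M X≐Y = mk⇔ (Indep-cong (vec M) X≐Y) (Indep-cong (vec M) (≐-sym X≐Y))

InClosure-cong : ∀ {m n} (vs : Fin m → Vec Bool n) {S S′ f} → S ≐ S′ → InClosure vs S f → InClosure vs S′ f
InClosure-cong vs S≐S′ (inj₁ f∈S) = inj₁ (≐⇒⊆ S≐S′ _ f∈S)
InClosure-cong vs S≐S′ (inj₂ dep) = inj₂ (Dep-cong (∪-cong S≐S′ ≐-refl) dep)

span-∅ : ∀ {m n} (vs : Fin m → Vec Bool n) {C w} → C ≐ ∅ → Span vs C w → w ≡ zeroV
span-∅ vs C≡∅ (spanned-by d d⊆C Σd≡w) = trans (sym Σd≡w) (lincomb-∅ vs (⊆-∅ (⊆-trans d⊆C (≐⇒⊆ C≡∅))))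

Indep-img : ∀ {k m n} (vs : Fin m → Vec Bool n) {φ : Fin k → Fin m} → Injective _≡_ _≡_ φ →
            ∀ X → Independent (vs ∘ φ) X ⇔ Independent vs (img φ X)
Indep-img vs {φ} φ-injective X = mk⇔ to-img from-img
  where
  to-img : Independent (vs ∘ φ) X → Independent vs (img φ X)
  to-img ind c c⊆φX Σc≡0 = ≐-trans (≐-sym c≐) (img-∅ φ c∘φ≡∅)
    where
    c≐ : img φ (c ∘ φ) ≐ c
    c≐ = img-preimage φ c (⊆-trans c⊆φX (img-mono φ ⊆-full))
    c∘φ⊆X : (c ∘ φ) ⊆ X
    c∘φ⊆X k ck with img⁻ φ (c⊆φX _ ck)
    ... | l , l∈X , φl≡φk = subst (_∈ X) (φ-injective φl≡φk) l∈X
    c∘φ≡∅ : c ∘ φ ≐ ∅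
    c∘φ≡∅ = ind (c ∘ φ) c∘φ⊆X
              (trans (sym (lincomb-img vs φ (c ∘ φ) λ _ _ → φ-injective)) (trans (lincomb-cong vs c≐) Σc≡0))
  from-img : Independent vs (img φ X) → Independent (vs ∘ φ) X
  from-img ind c c⊆X Σc≡0 i = ¬∈⇒∉ λ i∈c →
    ∉⇒¬∈ (ind (img φ c) (img-mono φ c⊆X) (trans (lincomb-img vs φ c λ _ _ → φ-injective) Σc≡0) (φ i)) (img⁺ φ i∈c refl)

Indep-same-cycles : ∀ {m n n′} (u : Fin m → Vec Bool n) (w : Fin m → Vec Bool n′) →
                    (∀ c → lincomb u c ≡ zeroV ⇔ lincomb w c ≡ zeroV) → ∀ X → Independent u X ⇔ Independent w X
Indep-same-cycles u w same X = mk⇔ (λ ind c c⊆X Σc≡0 → ind c c⊆X (from (same c) Σc≡0))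
                                   (λ ind c c⊆X Σc≡0 → ind c c⊆X (to (same c) Σc≡0))

-- Presentations of induced minors

-- In M / C the element f is a loop or is parallel to an element of the copy ψ.
LoopOrParallel : (M : SBM) {k : ℕ} → (Fin k → Fin (m M)) → Subset (m M) → Fin (m M) → Set
LoopOrParallel M ψ C f = InClosure (vec M) C f ⊎ ∃ λ i → InClosure (vec M) (C ∪ ⁅ ψ i ⁆) f

SpanLoopOrParallel : (M : SBM) {k : ℕ} → (Fin k → Fin (m M)) → Subset (m M) → Fin (m M) → Set
SpanLoopOrParallel M ψ C f = Span (vec M) C (vec M f) ⊎ ∃ λ i → Span (vec M) C (vec M f ⊕ vec M (ψ i))

-- K is presented as an induced minor of M: contracting C and restricting to the flat spanned by the copy
-- of K gives K back, up to the loops and parallel elements that simplification removes.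
record Presentation (K M : SBM) : Set where
  field
    copy       : Fin (m K) → Fin (m M)
    contracted : Subset (m M)
    indep⇔     : ∀ X → Indep K X ⇔ Indep M (img copy X ∪ contracted)
    closed     : ∀ {I f} → I ⊆ img copy full → Indep M (I ∪ contracted) →
                 InClosure (vec M) (I ∪ contracted) f → LoopOrParallel M copy contracted f

module _ {K M : SBM} {ψ : Fin (m K) → Fin (m M)} {C : Subset (m M)}
         (indep⇔ : ∀ X → Indep K X ⇔ Indep M (img ψ X ∪ C)) where

  contracted-independent : Indep M C
  contracted-independent = Indep-mono (vec M) (q⊆p∪q (img ψ ∅) C) (to (indep⇔ ∅) (Indep-∅ (vec K)))

  contracted-copy-independent : ∀ i → Indep M (C ∪ ⁅ ψ i ⁆)
  contracted-copy-independent i =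
    Indep-cong (vec M) (≐-trans (∪-cong (img-⁅⁆ ψ i) ≐-refl) (∪-comm _ C)) (to (indep⇔ ⁅ i ⁆) (single-indep K i))

-- φ identifies M₁ with a restriction of M / T.
module Embedding {M₁ M : SBM} (φ : Fin (m M₁) → Fin (m M)) (φ-injective : Injective _≡_ _≡_ φ)
                 (T : Subset (m M)) (φ∉T : ∀ j → φ j ∉ T)
                 (indep⇔ : ∀ X → Indep M₁ X ⇔ Indep M (img φ X ∪ T)) where

  img-∪⁅⁆ : ∀ S j → img φ (S ∪ ⁅ j ⁆) ∪ T ≐ (img φ S ∪ T) ∪ ⁅ φ j ⁆
  img-∪⁅⁆ S j = ≐-trans (∪-cong (≐-trans (img-∪ φ S ⁅ j ⁆) (∪-cong ≐-refl (img-⁅⁆ φ j))) ≐-refl)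
                        (∪-swapʳ (img φ S) ⁅ φ j ⁆ T)

  Dep-transport : ∀ {X} → Dep M₁ X → Dep M (img φ X ∪ T)
  Dep-transport dep = ¬Indep⇒Dep (vec M) (Dep⇒¬Indep dep ∘ from (indep⇔ _))

  Dep-reflect : ∀ {X} → Dep M (img φ X ∪ T) → Dep M₁ X
  Dep-reflect dep = ¬Indep⇒Dep (vec M₁) (Dep⇒¬Indep dep ∘ to (indep⇔ _))

  InClosure-transport : ∀ {S j} → InClosure (vec M₁) S j → InClosure (vec M) (img φ S ∪ T) (φ j)
  InClosure-transport {S} (inj₁ j∈S) = inj₁ (p⊆p∪q (img φ S) T _ (img⁺ φ j∈S refl))
  InClosure-transport {S} {j} (inj₂ dep) = inj₂ (Dep-cong (img-∪⁅⁆ S j) (Dep-transport dep))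

  InClosure-reflect : ∀ {S j} → InClosure (vec M) (img φ S ∪ T) (φ j) → InClosure (vec M₁) S j
  InClosure-reflect {S} {j} (inj₁ φj∈) with x∈p∪q⁻ (img φ S) T φj∈
  ... | inj₁ φj∈φS = let i , i∈S , φi≡φj = img⁻ φ φj∈φS in inj₁ (subst (_∈ S) (φ-injective φi≡φj) i∈S)
  ... | inj₂ φj∈T  = ⊥-elim (∉⇒¬∈ (φ∉T j) φj∈T)
  InClosure-reflect {S} {j} (inj₂ dep) = inj₂ (Dep-reflect (Dep-cong (≐-sym (img-∪⁅⁆ S j)) dep))

  LoopOrParallel-transport : ∀ {k} {ψ : Fin k → Fin (m M₁)} {C j} →
                             LoopOrParallel M₁ ψ C j → LoopOrParallel M (φ ∘ ψ) (img φ C ∪ T) (φ j)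
  LoopOrParallel-transport (inj₁ loop) = inj₁ (InClosure-transport loop)
  LoopOrParallel-transport {ψ = ψ} {C} (inj₂ (i , par)) =
    inj₂ (i , InClosure-cong (vec M) (img-∪⁅⁆ C (ψ i)) (InClosure-transport par))

  module Composed {K : SBM} (P₁ : Presentation K M₁) where
    open Presentation P₁ renaming (copy to ψ₁; contracted to C₁; indep⇔ to indep⇔₁; closed to closed₁)

    ψ : Fin (m K) → Fin (m M)
    ψ = φ ∘ ψ₁

    C : Subset (m M)
    C = img φ C₁ ∪ T

    img-split : ∀ A → img φ (A ∪ C₁) ∪ T ≐ img φ A ∪ C
    img-split A = ≐-trans (∪-cong (img-∪ φ A C₁) ≐-refl) (∪-assoc (img φ A) (img φ C₁) T)

    composed-indep⇔ : ∀ X → Indep K X ⇔ Indep M (img ψ X ∪ C)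
    composed-indep⇔ X =
      Indep-⇔ M (≐-trans (img-split (img ψ₁ X)) (∪-cong (img-∘ φ ψ₁ X) ≐-refl)) ⇔-∘ (indep⇔ _ ⇔-∘ indep⇔₁ X)

    C-indep : Indep M C
    C-indep = contracted-independent {K} {M} composed-indep⇔

    C∪ψ-indep : ∀ i → Indep M (C ∪ ⁅ ψ i ⁆)
    C∪ψ-indep = contracted-copy-independent {K} {M} composed-indep⇔

    closed-at-image : ∀ {I j} → I ⊆ img ψ full → Indep M (I ∪ C) → InClosure (vec M) (I ∪ C) (φ j) →
                      LoopOrParallel M ψ C (φ j)
    closed-at-image {I} {j} I⊆ψ indIC clj = LoopOrParallel-transport (closed₁ I₁⊆ψ₁ indI₁C₁ (InClosure-reflect clj′))
      where
      I₁ : Subset (m M₁)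
      I₁ = I ∘ φ
      I₁⊆ψ₁ : I₁ ⊆ img ψ₁ full
      I₁⊆ψ₁ k Iφk with img⁻ ψ (I⊆ψ _ Iφk)
      ... | i , _ , φψ₁i≡φk = img⁺ ψ₁ refl (φ-injective φψ₁i≡φk)
      I≐ : img φ (I₁ ∪ C₁) ∪ T ≐ I ∪ C
      I≐ = ≐-trans (img-split I₁) (∪-cong (img-preimage φ I (⊆-trans I⊆ψ (img-∘-full φ ψ₁))) ≐-refl)
      indI₁C₁ : Indep M₁ (I₁ ∪ C₁)
      indI₁C₁ = from (indep⇔ _) (Indep-cong (vec M) (≐-sym I≐) indIC)
      clj′ : InClosure (vec M) (img φ (I₁ ∪ C₁) ∪ T) (φ j)
      clj′ = InClosure-cong (vec M) (≐-sym I≐) clj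

LoopOrParallel-parallel : ∀ {M k} {ψ : Fin k → Fin (m M)} {C e f g} → Indep M C → (∀ i → Indep M (C ∪ ⁅ ψ i ⁆)) →
                          e ∈ C → vec M f ⊕ vec M g ≡ vec M e → LoopOrParallel M ψ C g → LoopOrParallel M ψ C f
LoopOrParallel-parallel {M} indC indCψ e∈C par (inj₁ loop) = inj₁ (InClosure-parallel (vec M) indC e∈C par loop)
LoopOrParallel-parallel {M} {ψ = ψ} {C = C} indC indCψ e∈C par (inj₂ (i , parallel)) =
  inj₂ (i , InClosure-parallel (vec M) (indCψ i) (p⊆p∪q C ⁅ ψ i ⁆ _ e∈C) par parallel)

presentation-iso : ∀ {K M} → Iso K M → Presentation K M
presentation-iso {K} {M} (φ , _ , φ-surjective , iso⇔) = record
  { copy       = φ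
  ; contracted = ∅
  ; indep⇔     = λ X → Indep-⇔ M (≐-sym (∪-∅ʳ (img φ X))) ⇔-∘ iso⇔ X
  ; closed     = λ {_} {f} _ _ _ → let j , φj≡f = φ-surjective f in
                   inj₂ (j , inj₁ (subst (λ x → x ∈ ⁅ φ j ⁆) (φj≡f refl) (x∈⁅x⁆ (φ j))))
  }

presentation-restr : ∀ {K M₁ M} → RestrFlat M₁ M → Presentation K M₁ → Presentation K M
presentation-restr {K} {M₁} {M} (φ , F , flat , φ-injective , onto-F , φ∈F , restr⇔) P₁ = record
  { copy       = ψ
  ; contracted = C
  ; indep⇔     = composed-indep⇔
  ; closed     = closed
  }
  where
  open Embedding {M₁} {M} φ φ-injective ∅ (λ _ → refl) (λ X → Indep-⇔ M (≐-sym (∪-∅ʳ (img φ X))) ⇔-∘ restr⇔ X)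
  open Composed P₁
  closed : ∀ {I f} → I ⊆ img ψ full → Indep M (I ∪ C) → InClosure (vec M) (I ∪ C) f → LoopOrParallel M ψ C f
  closed {I} {f} I⊆ψ indIC clf with F f in Ff
  ... | true  = let j , φj≡f = onto-F f Ff in
                subst (LoopOrParallel M ψ C) φj≡f (closed-at-image I⊆ψ indIC (subst (InClosure (vec M) (I ∪ C)) (sym φj≡f) clf))
  ... | false = ⊥-elim ([ ∉⇒¬∈ (¬∈⇒∉ (∉⇒¬∈ Ff ∘ IC⊆F f))
                         , (λ dep → Dep⇒¬Indep dep (flat f Ff _ IC⊆F indIC)) ]′ clf)
    where
    φ-in-F : img φ full ⊆ F
    φ-in-F j h = let i , _ , φi≡j = img⁻ φ h in subst (_∈ F) φi≡j (φ∈F i)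
    IC⊆F : (I ∪ C) ⊆ F
    IC⊆F = ∪-least (⊆-trans I⊆ψ (⊆-trans (img-∘-full φ (Presentation.copy P₁)) φ-in-F))
                   (∪-least (⊆-trans (img-mono φ ⊆-full) φ-in-F) (λ _ ()))

presentation-contr : ∀ {K M₁ M} → ContrSi M₁ M → Presentation K M₁ → Presentation K M
presentation-contr {K} {M₁} {M} (e , φ , φ-injective , φ≢e , cover , contr⇔) P₁ = record
  { copy       = ψ
  ; contracted = C
  ; indep⇔     = composed-indep⇔
  ; closed     = closed
  }
  where
  open Embedding {M₁} {M} φ φ-injective ⁅ e ⁆ (x≢y⇒x∉⁅y⁆ ∘ φ≢e) contr⇔
  open Composed P₁
  e∈C : e ∈ C
  e∈C = q⊆p∪q (img φ (Presentation.contracted P₁)) ⁅ e ⁆ e (x∈⁅x⁆ e)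
  closed : ∀ {I f} → I ⊆ img ψ full → Indep M (I ∪ C) → InClosure (vec M) (I ∪ C) f → LoopOrParallel M ψ C f
  closed {I} {f} I⊆ψ indIC clf = by-cases (f ≟ e) (cover f)
    where
    at-image : ∀ {j} → f ≡ φ j → LoopOrParallel M ψ C f
    at-image f≡φj = subst (LoopOrParallel M ψ C) (sym f≡φj)
                      (closed-at-image I⊆ψ indIC (subst (InClosure (vec M) (I ∪ C)) f≡φj clf))
    by-cases : Dec (f ≡ e) → (f ≢ e → ∃ λ j → f ≡ φ j ⊎ ¬ Indep M (⁅ f ⁆ ∪ ⁅ φ j ⁆ ∪ ⁅ e ⁆)) →
               LoopOrParallel M ψ C f
    by-cases (yes refl) _ = inj₁ (inj₁ e∈C)
    by-cases (no f≢e) cover-f with cover-f f≢e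
    ... | j , inj₁ f≡φj = at-image f≡φj
    ... | j , inj₂ f-φj-e-dependent with f ≟ φ j
    ...   | yes f≡φj = at-image f≡φj
    ...   | no f≢φj =
      LoopOrParallel-parallel {M} C-indep C∪ψ-indep e∈C par
        (closed-at-image I⊆ψ indIC (InClosure-parallel (vec M) indIC (q⊆p∪q I C e e∈C) (trans (⊕-comm _ _) par) clf))
      where
      -- f and φ j are parallel in M / e, and e is contracted
      par : vec M f ⊕ vec M (φ j) ≡ vec M e
      par = Dep-triple⇒sum M (¬Indep⇒Dep (vec M) f-φj-e-dependent) f≢φj f≢e (φ≢e j)

presentation : ∀ {K M} → IndMinor K M → Presentation K M
presentation (done iso)          = presentation-iso iso
presentation (step (restr r) im) = presentation-restr r (presentation im)
presentation (step (contr c) im) = presentation-contr c (presentation im)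

LoopOrParallel⇒span : ∀ {M k} {ψ : Fin k → Fin (m M)} {C f} → Indep M C → (∀ i → Indep M (C ∪ ⁅ ψ i ⁆)) →
                      LoopOrParallel M ψ C f → SpanLoopOrParallel M ψ C f
LoopOrParallel⇒span {M} indC indCψ (inj₁ loop) = inj₁ (InClosure⇒Span (vec M) indC loop)
LoopOrParallel⇒span {M} indC indCψ (inj₂ (i , parallel)) with span-∪⁅⁆⁻ (vec M) (InClosure⇒Span (vec M) (indCψ i) parallel)
... | inj₁ sp = inj₁ sp
... | inj₂ sp = inj₂ (i , sp)

-- Linear presentations

-- A presentation in linear terms, in which contracting an element of C becomes a projection.
record LinearPresentation (K M : SBM) (ψ : Fin (m K) → Fin (m M)) (C : Subset (m M)) : Set where
  field
    contracted-indep : Indep M C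
    span⇔cycle       : ∀ a → Span (vec M) C (lincomb (vec M ∘ ψ) a) ⇔ lincomb (vec K) a ≡ zeroV
    closed           : ∀ f → Span (vec M) (img ψ full ∪ C) (vec M f) → SpanLoopOrParallel M ψ C f

  copy-∉span : ∀ i → ¬ Span (vec M) C (vec M (ψ i))
  copy-∉span i sp = nonzero K i (trans (sym (lincomb-⁅⁆ (vec K) i))
                      (to (span⇔cycle ⁅ i ⁆) (subst (Span (vec M) C) (sym (lincomb-⁅⁆ (vec M ∘ ψ) i)) sp)))

  copy-∉ : ∀ i → ψ i ∉ C
  copy-∉ i = ¬∈⇒∉ (copy-∉span i ∘ span-∈)

  copy-pair-∉span : ∀ {i j} → i ≢ j → ¬ Span (vec M) C (vec M (ψ i) ⊕ vec M (ψ j))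
  copy-pair-∉span {i} {j} i≢j sp = i≢j (distinct K (⊕≡0⇒≡ (trans (sym (lincomb-pair (vec K) i j))
    (to (span⇔cycle (⁅ i ⁆ ⊻ ⁅ j ⁆)) (subst (Span (vec M) C) (sym (lincomb-pair (vec M ∘ ψ) i j)) sp)))))

  copy-injective : Injective _≡_ _≡_ ψ
  copy-injective {i} {j} ψi≡ψj with i ≟ j
  ... | yes i≡j = i≡j
  ... | no  i≢j = ⊥-elim (copy-pair-∉span i≢j (subst (Span (vec M) C) Σ≡0 span-0))
    where
    Σ≡0 : zeroV ≡ vec M (ψ i) ⊕ vec M (ψ j)
    Σ≡0 = sym (trans (cong (λ x → vec M x ⊕ vec M (ψ j)) ψi≡ψj) (⊕-self _))

  parallel-mod-contracted : ∀ {s t} → s ∈ (img ψ full ∪ C) → t ∈ (img ψ full ∪ C) →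
                            Span (vec M) C (vec M s ⊕ vec M t) → s ≡ t ⊎ (s ∈ C × t ∈ C)
  parallel-mod-contracted {s} {t} s∈ t∈ sp with x∈p∪q⁻ (img ψ full) C s∈ | x∈p∪q⁻ (img ψ full) C t∈
  ... | inj₂ s∈C | inj₂ t∈C = inj₂ (s∈C , t∈C)
  ... | inj₁ s∈ψ | inj₁ t∈ψ with img⁻ ψ s∈ψ | img⁻ ψ t∈ψ
  ...   | i , _ , refl | j , _ , refl with i ≟ j
  ...     | yes refl = inj₁ refl
  ...     | no  i≢j  = ⊥-elim (copy-pair-∉span i≢j sp)
  parallel-mod-contracted {s} {t} s∈ t∈ sp | inj₁ s∈ψ | inj₂ t∈C with img⁻ ψ s∈ψ
  ... | i , _ , refl = ⊥-elim (copy-∉span i (subst (Span (vec M) C) (⊕-cancelʳ _ _) (span-⊕ sp (span-∈ t∈C))))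
  parallel-mod-contracted {s} {t} s∈ t∈ sp | inj₂ s∈C | inj₁ t∈ψ with img⁻ ψ t∈ψ
  ... | j , _ , refl = ⊥-elim (copy-∉span j (subst (Span (vec M) C) (⊕-cancelˡ _ _) (span-⊕ (span-∈ s∈C) sp)))

  span-copy : ∀ a → Span (vec M) (img ψ full ∪ C) (lincomb (vec M ∘ ψ) a)
  span-copy a = spanned-by (img ψ a) (⊆-trans (img-mono ψ {a} {full} ⊆-full) (p⊆p∪q (img ψ full) C))
                           (lincomb-img (vec M) ψ a λ _ _ → copy-injective)

  span-copy-∪⁻ : ∀ {w} → Span (vec M) (img ψ full ∪ C) w → ∃ λ b → Span (vec M) C (lincomb (vec M ∘ ψ) b ⊕ w)
  span-copy-∪⁻ = span-img-∪⁻ (vec M) copy-injective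

-- With nothing left to contract, the copy spans a flat isomorphic to K.
presentation-restriction : ∀ {K M ψ C} → LinearPresentation K M ψ C → C ≐ ∅ → IndMinor K M
presentation-restriction {K} {M} {ψ} {C} P C≡∅ =
  step {M₁ = M|ψ} (restr (ψ , img ψ full , flat , copy-injective , onto , ψ∈F , Indep-img (vec M) copy-injective)) (done iso)
  where
  open LinearPresentation P
  M|ψ : SBM
  M|ψ = record { m = m K ; n = n M ; vec = vec M ∘ ψ ; nonzero = nonzero M ∘ ψ ; distinct = copy-injective ∘ distinct M }
  flat : IsFlat M (img ψ full)
  flat f f∉F I I⊆F indI with independent? (vec M) (I ∪ ⁅ f ⁆)
  ... | yes ind = ind
  ... | no ¬ind
    with closed f (span-mono (⊆-trans I⊆F (p⊆p∪q _ C)) (InClosure⇒Span (vec M) indI (inj₂ (¬Indep⇒Dep (vec M) ¬ind))))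
  ...   | inj₁ sp       = ⊥-elim (nonzero M f (span-∅ (vec M) C≡∅ sp))
  ...   | inj₂ (i , sp) = ⊥-elim (∉⇒¬∈ f∉F (img⁺ ψ refl (sym (distinct M (⊕≡0⇒≡ (span-∅ (vec M) C≡∅ sp))))))
  onto : ∀ j → j ∈ img ψ full → ∃ λ i → ψ i ≡ j
  onto j h = let i , _ , ψi≡j = img⁻ ψ h in i , ψi≡j
  ψ∈F : ∀ i → ψ i ∈ img ψ full
  ψ∈F i = img⁺ ψ refl refl
  same-cycles : ∀ c → lincomb (vec K) c ≡ zeroV ⇔ lincomb (vec M ∘ ψ) c ≡ zeroV
  same-cycles c = mk⇔ (span-∅ (vec M) C≡∅ ∘ from (span⇔cycle c))
                      (λ z → to (span⇔cycle c) (subst (Span (vec M) C) (sym z) span-0))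
  iso : Iso K M|ψ
  iso = id , id , (λ j → j , λ z≡j → z≡j) ,
        λ X → Indep-⇔ M|ψ (≐-sym (img-id X)) ⇔-∘ Indep-same-cycles (vec K) (vec M ∘ ψ) same-cycles X

-- Contraction

-- M′ is si(M / e), realised by a linear map π whose kernel is spanned by the vector of e: rep sends each
-- element other than e to its parallel class in M / e, and lift chooses a representative of each class.
record LinearContraction (M′ M : SBM) (e : Fin (m M)) : Set where
  field
    π        : Vec Bool (n M) → Vec Bool (n M′)
    π-⊕      : ∀ u w → π (u ⊕ w) ≡ π u ⊕ π w
    π-e      : π (vec M e) ≡ zeroV
    π-kernel : ∀ w → π w ≡ zeroV → w ≡ zeroV ⊎ w ≡ vec M e
    rep      : Fin (m M) → Fin (m M′)
    π-rep    : ∀ t → t ≢ e → π (vec M t) ≡ vec M′ (rep t)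
    lift     : Fin (m M′) → Fin (m M)
    lift-≢   : ∀ j → lift j ≢ e
    rep-lift : ∀ j → rep (lift j) ≡ j

  π-0 : π zeroV ≡ zeroV
  π-0 = begin
    π zeroV                ≡⟨ cong π (⊕-self zeroV) ⟨
    π (zeroV ⊕ zeroV)      ≡⟨ π-⊕ zeroV zeroV ⟩
    π zeroV ⊕ π zeroV      ≡⟨ ⊕-self (π zeroV) ⟩
    zeroV                  ∎
    where open ≡-Reasoning

  π-lincomb : ∀ {k} (v : Fin k → Vec Bool (n M)) c → lincomb (π ∘ v) c ≡ π (lincomb v c)
  π-lincomb = lincomb-map π π-⊕ π-0

  π≡0⇒span-e : ∀ {w} → π w ≡ zeroV → Span (vec M) ⁅ e ⁆ w
  π≡0⇒span-e {w} πw≡0 with π-kernel w πw≡0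
  ... | inj₁ w≡0  = subst (Span (vec M) ⁅ e ⁆) (sym w≡0) span-0
  ... | inj₂ w≡ve = subst (Span (vec M) ⁅ e ⁆) (sym w≡ve) (span-∈ (x∈⁅x⁆ e))

  span-e⇒π≡0 : ∀ {w} → Span (vec M) ⁅ e ⁆ w → π w ≡ zeroV
  span-e⇒π≡0 sp with span-⁅⁆ (vec M) sp
  ... | inj₁ w≡0  = trans (cong π w≡0) π-0
  ... | inj₂ w≡ve = trans (cong π w≡ve) π-e

  lift-injective : Injective _≡_ _≡_ lift
  lift-injective {i} {j} lifti≡liftj = trans (sym (rep-lift i)) (trans (cong rep lifti≡liftj) (rep-lift j))

  vec-lift : ∀ j → π (vec M (lift j)) ≡ vec M′ j
  vec-lift j = trans (π-rep (lift j) (lift-≢ j)) (cong (vec M′) (rep-lift j))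

  lincomb-lift : ∀ c → lincomb (vec M′) c ≡ π (lincomb (vec M) (img lift c))
  lincomb-lift c = begin
    lincomb (vec M′) c                       ≡⟨ lincomb-cong-on c (λ j _ → vec-lift j) ⟨
    lincomb (π ∘ vec M ∘ lift) c             ≡⟨ π-lincomb (vec M ∘ lift) c ⟩
    π (lincomb (vec M ∘ lift) c)             ≡⟨ cong π (lincomb-img (vec M) lift c λ _ _ → lift-injective) ⟨
    π (lincomb (vec M) (img lift c))         ∎
    where open ≡-Reasoning

  lincomb-rep : ∀ {S d} → (∀ t → t ∈ S → t ≢ e) → InjectiveOn rep S → d ⊆ S →
                lincomb (vec M′) (img rep d) ≡ π (lincomb (vec M) d)
  lincomb-rep {S} {d} S∌e rep-inj d⊆S = begin
    lincomb (vec M′) (img rep d)    ≡⟨ lincomb-img (vec M′) rep d (λ di dj → rep-inj (d⊆S _ di) (d⊆S _ dj)) ⟩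
    lincomb (vec M′ ∘ rep) d        ≡⟨ lincomb-cong-on d (λ t t∈d → π-rep t (S∌e t (d⊆S t t∈d))) ⟨
    lincomb (π ∘ vec M) d           ≡⟨ π-lincomb (vec M) d ⟩
    π (lincomb (vec M) d)           ∎
    where open ≡-Reasoning

  span-contract : ∀ {S w} → e ∈ S → InjectiveOn rep (S ∖ ⁅ e ⁆) →
                  Span (vec M) S w ⇔ Span (vec M′) (img rep (S ∖ ⁅ e ⁆)) (π w)
  span-contract {S} {w} e∈S rep-inj = mk⇔ push pull
    where
    S∖e∌e : ∀ t → t ∈ S ∖ ⁅ e ⁆ → t ≢ e
    S∖e∌e t t∈ refl = ∉⇒¬∈ (trans (cong (λ b → S e ∧ not b) (x∈⁅x⁆ e)) (∧-zeroʳ (S e))) t∈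
    push : Span (vec M) S w → Span (vec M′) (img rep (S ∖ ⁅ e ⁆)) (π w)
    push (spanned-by d d⊆S Σd≡w) = spanned-by (img rep (d ∖ ⁅ e ⁆)) (img-mono rep d∖e⊆S∖e) (begin
      lincomb (vec M′) (img rep (d ∖ ⁅ e ⁆))            ≡⟨ lincomb-rep S∖e∌e rep-inj d∖e⊆S∖e ⟩
      π (lincomb (vec M) (d ∖ ⁅ e ⁆))                   ≡⟨ ⊕-identityˡ _ ⟨
      zeroV ⊕ π (lincomb (vec M) (d ∖ ⁅ e ⁆))
        ≡⟨ cong (_⊕ _) (span-e⇒π≡0 (spanned-by (d ∩ ⁅ e ⁆) (p∩q⊆q d ⁅ e ⁆) refl)) ⟨
      π (lincomb (vec M) (d ∩ ⁅ e ⁆)) ⊕ π (lincomb (vec M) (d ∖ ⁅ e ⁆))  ≡⟨ π-⊕ _ _ ⟨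
      π (lincomb (vec M) (d ∩ ⁅ e ⁆) ⊕ lincomb (vec M) (d ∖ ⁅ e ⁆))    ≡⟨ cong π (lincomb-split (vec M) d ⁅ e ⁆) ⟨
      π (lincomb (vec M) d)                             ≡⟨ cong π Σd≡w ⟩
      π w                                               ∎)
      where
      open ≡-Reasoning
      d∖e⊆S∖e : (d ∖ ⁅ e ⁆) ⊆ (S ∖ ⁅ e ⁆)
      d∖e⊆S∖e i h with d i in di
      ... | true = subst (λ b → b ∧ not (⁅ e ⁆ i) ≡ true) (sym (d⊆S i di)) h
    pull : Span (vec M′) (img rep (S ∖ ⁅ e ⁆)) (π w) → Span (vec M) S w
    pull (spanned-by d′ d′⊆ Σd′≡πw) = [ via-0 , via-e ]′ (π-kernel (lincomb (vec M) d ⊕ w) π≡0)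
      where
      d = (S ∖ ⁅ e ⁆) ∩ (d′ ∘ rep)
      d⊆S : d ⊆ S
      d⊆S = ⊆-trans (p∩q⊆p (S ∖ ⁅ e ⁆) (d′ ∘ rep)) (p∖q⊆p S ⁅ e ⁆)
      π≡0 : π (lincomb (vec M) d ⊕ w) ≡ zeroV
      π≡0 = trans (π-⊕ _ w) (trans (cong (_⊕ π w) (trans (sym (lincomb-rep S∖e∌e rep-inj (p∩q⊆p _ _)))
                    (trans (lincomb-cong (vec M′) (img-restrict rep d′⊆)) Σd′≡πw))) (⊕-self (π w)))
      via-0 : lincomb (vec M) d ⊕ w ≡ zeroV → Span (vec M) S w
      via-0 Σd⊕w≡0 = spanned-by d d⊆S (⊕≡0⇒≡ Σd⊕w≡0)
      via-e : lincomb (vec M) d ⊕ w ≡ vec M e → Span (vec M) S w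
      via-e Σd⊕w≡ve = subst (Span (vec M) S) (⊕-cancelˡ _ w)
                        (span-⊕ (spanned-by d d⊆S refl) (subst (Span (vec M) S) (sym Σd⊕w≡ve) (span-∈ e∈S)))

  contraction-step : ContrSi M′ M
  contraction-step = e , lift , lift-injective , lift-≢ , cover , indep⇔
    where
    cover : ∀ f → f ≢ e → ∃ λ j → f ≡ lift j ⊎ ¬ Indep M (⁅ f ⁆ ∪ ⁅ lift j ⁆ ∪ ⁅ e ⁆)
    cover f f≢e with f ≟ lift (rep f)
    ... | yes f≡lift = rep f , inj₁ f≡lift
    ... | no  f≢lift with π-kernel (vec M f ⊕ vec M (lift (rep f)))
                            (trans (π-⊕ _ _) (trans (cong₂ _⊕_ (π-rep f f≢e) (vec-lift (rep f))) (⊕-self _)))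
    ...   | inj₁ Σ≡0  = ⊥-elim (f≢lift (distinct M (⊕≡0⇒≡ Σ≡0)))
    ...   | inj₂ Σ≡ve = rep f , inj₂ (Dep⇒¬Indep (sum⇒Dep-triple (vec M) Σ≡ve f≢lift f≢e))
    indep⇔ : ∀ X → Indep M′ X ⇔ Indep M (img lift X ∪ ⁅ e ⁆)
    indep⇔ X = mk⇔ to-M from-M
      where
      to-M : Indep M′ X → Indep M (img lift X ∪ ⁅ e ⁆)
      to-M ind = IndependentMod⇒Indep-∪ (vec M) (single-indep M e) λ a a⊆ spa →
        let a≐ = img-preimage lift a (⊆-trans a⊆ (img-mono lift ⊆-full)) in
        ≐-trans (≐-sym a≐) (img-∅ lift (ind (a ∘ lift) (preimage⊆ a⊆)
          (trans (lincomb-lift (a ∘ lift)) (trans (cong π (lincomb-cong (vec M) a≐)) (span-e⇒π≡0 spa)))))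
        where
        preimage⊆ : ∀ {a} → a ⊆ img lift X → (a ∘ lift) ⊆ X
        preimage⊆ a⊆ k ak with img⁻ lift (a⊆ _ ak)
        ... | l , l∈X , lift-l≡lift-k = subst (_∈ X) (lift-injective lift-l≡lift-k) l∈X
      from-M : Indep M (img lift X ∪ ⁅ e ⁆) → Indep M′ X
      from-M ind c c⊆X Σc≡0 i = ¬∈⇒∉ λ i∈c →
        ∉⇒¬∈ (Indep-∪⇒IndependentMod (vec M) ind lift-X∌e (img lift c) (img-mono lift c⊆X)
                (π≡0⇒span-e (trans (sym (lincomb-lift c)) Σc≡0)) (lift i))
             (img⁺ lift i∈c refl)
        where
        lift-X∌e : Disjoint (img lift X) ⁅ e ⁆
        lift-X∌e j h = let l , _ , lift-l≡j = img⁻ lift h in x≢y⇒x∉⁅y⁆ (lift-≢ l ∘ trans lift-l≡j)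

module _ {K M M′ : SBM} {ψ : Fin (m K) → Fin (m M)} {C : Subset (m M)} {e : Fin (m M)}
         (P : LinearPresentation K M ψ C) (e∈C : e ∈ C) (L : LinearContraction M′ M e) where
  open LinearPresentation P
  open LinearContraction L

  private
    Q : Subset (m M)
    Q = img ψ full ∪ C

    C′ : Subset (m M′)
    C′ = img rep (C ∖ ⁅ e ⁆)

    copy-≢e : ∀ i → ψ i ≢ e
    copy-≢e i ψi≡e = ∉⇒¬∈ (copy-∉ i) (subst (_∈ C) (sym ψi≡e) e∈C)

    Q∖e≐ : Q ∖ ⁅ e ⁆ ≐ img ψ full ∪ (C ∖ ⁅ e ⁆)
    Q∖e≐ j with img ψ full j in ψj | ⁅ e ⁆ j in ej
    ... | false | _     = refl
    ... | true  | false = refl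
    ... | true  | true  = ⊥-elim (copy-≢e i (trans ψi≡j (x∈⁅y⁆⇒x≡y ej)))
      where
      i = proj₁ (img⁻ ψ {full} ψj)
      ψi≡j = proj₂ (proj₂ (img⁻ ψ {full} ψj))

    rep-injective : InjectiveOn rep (Q ∖ ⁅ e ⁆)
    rep-injective {s} {t} s∈ t∈ reps≡rept with s ≟ t
    ... | yes s≡t = s≡t
    ... | no  s≢t with π-kernel (vec M s ⊕ vec M t)
                         (trans (π-⊕ _ _) (trans (cong₂ _⊕_ (π-rep s (x∈p∖⁅y⁆⇒x≢y {X = Q} s∈))
                                                            (π-rep t (x∈p∖⁅y⁆⇒x≢y {X = Q} t∈)))
                                (trans (cong (λ j → vec M′ (rep s) ⊕ vec M′ j) (sym reps≡rept)) (⊕-self _))))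
    ... | inj₁ Σ≡0  = ⊥-elim (s≢t (distinct M (⊕≡0⇒≡ Σ≡0)))
    ... | inj₂ Σ≡ve with parallel-mod-contracted (p∖q⊆p Q ⁅ e ⁆ s s∈) (p∖q⊆p Q ⁅ e ⁆ t t∈)
                           (subst (Span (vec M) C) (sym Σ≡ve) (span-∈ e∈C))
    ...   | inj₁ s≡t         = s≡t
    ...   | inj₂ (s∈C , t∈C) =
      ⊥-elim (Dep⇒¬Indep (Dep-mono triple⊆C (sum⇒Dep-triple (vec M) Σ≡ve s≢t (x∈p∖⁅y⁆⇒x≢y {X = Q} s∈)))
                         contracted-indep)
      where
      triple⊆C : (⁅ s ⁆ ∪ ⁅ t ⁆ ∪ ⁅ e ⁆) ⊆ C
      triple⊆C = ∪-least (x∈p⇒⁅x⁆⊆p s∈C) (∪-least (x∈p⇒⁅x⁆⊆p t∈C) (x∈p⇒⁅x⁆⊆p e∈C))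

    C∖e⊆Q∖e : (C ∖ ⁅ e ⁆) ⊆ (Q ∖ ⁅ e ⁆)
    C∖e⊆Q∖e = ⊆-trans (q⊆p∪q (img ψ full) (C ∖ ⁅ e ⁆)) (≐⇒⊆ (≐-sym Q∖e≐))

    C∖e-injective : InjectiveOn rep (C ∖ ⁅ e ⁆)
    C∖e-injective s∈ t∈ = rep-injective (C∖e⊆Q∖e _ s∈) (C∖e⊆Q∖e _ t∈)

    span-contract-C : ∀ {w} → Span (vec M) C w ⇔ Span (vec M′) C′ (π w)
    span-contract-C = span-contract e∈C C∖e-injective

    span-contract-Q : ∀ {w} → Span (vec M) Q w ⇔ Span (vec M′) (img rep (Q ∖ ⁅ e ⁆)) (π w)
    span-contract-Q = span-contract (q⊆p∪q (img ψ full) C e e∈C) rep-injective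

    lincomb-copy′ : ∀ a → lincomb (vec M′ ∘ rep ∘ ψ) a ≡ π (lincomb (vec M ∘ ψ) a)
    lincomb-copy′ a = trans (sym (lincomb-cong-on a λ i _ → π-rep (ψ i) (copy-≢e i))) (π-lincomb (vec M ∘ ψ) a)

    copy′∪C′≐ : img (rep ∘ ψ) full ∪ C′ ≐ img rep (Q ∖ ⁅ e ⁆)
    copy′∪C′≐ = ≐-trans (∪-cong (≐-sym (img-∘ rep ψ full)) ≐-refl)
                        (≐-trans (≐-sym (img-∪ rep _ _)) (img-cong rep (≐-sym Q∖e≐)))

    C′-indep : Indep M′ C′
    C′-indep c′ c′⊆ Σc′≡0 = ≐-trans (≐-sym (img-restrict rep {C ∖ ⁅ e ⁆} {c′} c′⊆)) (img-∅ rep {d} d≐∅)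
      where
      d = (C ∖ ⁅ e ⁆) ∩ (c′ ∘ rep)
      d⊆ : d ⊆ (C ∖ ⁅ e ⁆)
      d⊆ = p∩q⊆p _ _
      d≐∅ : d ≐ ∅
      d≐∅ = Indep-∪⇒IndependentMod (vec M) (Indep-cong (vec M) (≐-sym (∖∪-cancel (x∈p⇒⁅x⁆⊆p e∈C))) contracted-indep)
              (p∖q-disjoint C ⁅ e ⁆) d d⊆
              (π≡0⇒span-e (trans (sym (lincomb-rep {C ∖ ⁅ e ⁆} {d} (λ t → x∈p∖⁅y⁆⇒x≢y {X = C}) C∖e-injective d⊆))
                                 (trans (lincomb-cong (vec M′) (img-restrict rep {C ∖ ⁅ e ⁆} {c′} c′⊆)) Σc′≡0)))

  contract-presentation : LinearPresentation K M′ (rep ∘ ψ) (img rep (C ∖ ⁅ e ⁆))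
  contract-presentation = record
    { contracted-indep = C′-indep
    ; span⇔cycle       = λ a → span⇔cycle a ⇔-∘ span⇔span a
    ; closed           = closed′
    }
    where
    span⇔span : ∀ a → Span (vec M′) C′ (lincomb (vec M′ ∘ rep ∘ ψ) a) ⇔
                      Span (vec M) C (lincomb (vec M ∘ ψ) a)
    span⇔span a = mk⇔ (from span-contract-C ∘ subst (Span (vec M′) _) (lincomb-copy′ a))
                      (subst (Span (vec M′) _) (sym (lincomb-copy′ a)) ∘ to span-contract-C)
    closed′ : ∀ f′ → Span (vec M′) (img (rep ∘ ψ) full ∪ C′) (vec M′ f′) → SpanLoopOrParallel M′ (rep ∘ ψ) C′ f′
    closed′ f′ sp = [ loop , parallel ]′ (closed (lift f′) lift-f′∈⟨Q⟩)
      where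
      lift-f′∈⟨Q⟩ : Span (vec M) Q (vec M (lift f′))
      lift-f′∈⟨Q⟩ = from (span-contract-Q {vec M (lift f′)})
        (subst (Span (vec M′) (img rep (Q ∖ ⁅ e ⁆))) (sym (vec-lift f′)) (span-mono (≐⇒⊆ copy′∪C′≐) sp))
      loop : Span (vec M) C (vec M (lift f′)) → _
      loop sp′ = inj₁ (subst (Span (vec M′) C′) (vec-lift f′) (to (span-contract-C {vec M (lift f′)}) sp′))
      parallel : (∃ λ i → Span (vec M) C (vec M (lift f′) ⊕ vec M (ψ i))) → _
      parallel (i , sp′) = inj₂ (i , subst (Span (vec M′) C′)
        (trans (π-⊕ (vec M (lift f′)) (vec M (ψ i))) (cong₂ _⊕_ (vec-lift f′) (π-rep (ψ i) (copy-≢e i))))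
        (to (span-contract-C {vec M (lift f′) ⊕ vec M (ψ i)}) sp′))

nonzero-coordinate : ∀ {n} (u : Vec Bool n) → u ≢ zeroV → ∃ λ k → lookup u k ≡ true
nonzero-coordinate []          u≢0 = ⊥-elim (u≢0 refl)
nonzero-coordinate (true ∷ u)  u≢0 = zero , refl
nonzero-coordinate (false ∷ u) u≢0 = let k , u[k] = nonzero-coordinate u (u≢0 ∘ cong (false ∷_)) in suc k , u[k]

-- the projection along u onto the coordinate hyperplane {w | w[k] = 0}, where u[k] = 1
module Projection {n} (u : Vec Bool n) (k : Fin n) (u[k] : lookup u k ≡ true) where

  project : Vec Bool n → Vec Bool n
  project w = lookup w k · u ⊕ w

  project-⊕ : ∀ w w′ → project (w ⊕ w′) ≡ project w ⊕ project w′
  project-⊕ w w′ = begin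
    lookup (w ⊕ w′) k · u ⊕ (w ⊕ w′)
      ≡⟨ cong (λ b → b · u ⊕ (w ⊕ w′)) (lookup-zipWith _xor_ k w w′) ⟩
    (lookup w k xor lookup w′ k) · u ⊕ (w ⊕ w′)
      ≡⟨ cong (_⊕ (w ⊕ w′)) (·-xor (lookup w k) (lookup w′ k) u) ⟩
    (lookup w k · u ⊕ lookup w′ k · u) ⊕ (w ⊕ w′)
      ≡⟨ ⊕-interchange _ _ w w′ ⟩
    project w ⊕ project w′
      ∎
    where open ≡-Reasoning

  project-u : project u ≡ zeroV
  project-u rewrite u[k] = ⊕-self u

  project-kernel : ∀ w → project w ≡ zeroV → w ≡ zeroV ⊎ w ≡ u
  project-kernel w pw≡0 with lookup w k | ⊕≡0⇒≡ pw≡0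
  ... | false | 0≡w = inj₁ (sym 0≡w)
  ... | true  | u≡w = inj₂ (sym u≡w)

lookup-injective : ∀ {A : Set} {xs : List A} → Unique xs → ∀ {i j} → List.lookup xs i ≡ List.lookup xs j → i ≡ j
lookup-injective (_ ∷ _)        {zero}  {zero}  _  = refl
lookup-injective (x∉xs ∷ _)     {zero}  {suc j} eq = ⊥-elim (All.lookup x∉xs (∈-lookup j) eq)
lookup-injective (x∉xs ∷ _)     {suc i} {zero}  eq = ⊥-elim (All.lookup x∉xs (∈-lookup i) (sym eq))
lookup-injective (_ ∷ unique)   {suc i} {suc j} eq = cong suc (lookup-injective unique eq)

-- si(M / e): the elements other than e, projected along the vector of e, one representative per parallel class
-- (the smaller of two parallel elements); d is any element other than e, serving as the image of e.
module CanonicalContraction (M : SBM) (e d : Fin (m M)) (d≢e : d ≢ e) where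

  private
    ve = vec M e
    k = proj₁ (nonzero-coordinate ve (nonzero M e))
  open Projection ve k (proj₂ (nonzero-coordinate ve (nonzero M e)))

  Representative : Fin (m M) → Set
  Representative t = t ≢ e × ∀ g → vec M g ≡ vec M t ⊕ ve → t < g

  representative? : ∀ t → Dec (Representative t)
  representative? t = ¬? (t ≟ e) ×-dec all? λ g → (vec M g ≟ᵛ vec M t ⊕ ve) →-dec (t <? g)

  representatives : List (Fin (m M))
  representatives = filter representative? (allFin (m M))

  lift : Fin (List.length representatives) → Fin (m M)
  lift = List.lookup representatives

  lift-injective : Injective _≡_ _≡_ lift
  lift-injective = lookup-injective (Unique.filter⁺ representative? (Unique.allFin⁺ (m M)))

  lift-representative : ∀ j → Representative (lift j)
  lift-representative j = proj₂ (∈-filter⁻ representative? {xs = allFin (m M)} (∈-lookup j))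

  index : ∀ {t} → Representative t → Fin (List.length representatives)
  index {t} r = Any.index (∈-filter⁺ representative? (∈-allFin t) r)

  lift-index : ∀ {t} (r : Representative t) → lift (index r) ≡ t
  lift-index {t} r = sym (lookup-index (∈-filter⁺ representative? (∈-allFin t) r))

  class-representative : ∀ t → t ≢ e → ∃ λ g → Representative g × project (vec M g) ≡ project (vec M t)
  class-representative t t≢e with representative? t
  ... | yes r = t , r , refl
  ... | no ¬r with any? (λ g → (vec M g ≟ᵛ vec M t ⊕ ve) ×-dec ¬? (t <? g))
  ...   | no ¬partner = ⊥-elim (¬r (t≢e , λ g vg≡ → decidable-stable (t <? g) λ t≮g → ¬partner (g , vg≡ , t≮g)))
  ...   | yes (g , vg≡ , t≮g) = g , (g≢e , g-least) , project-partner
    where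
    vt≡ : vec M t ≡ vec M g ⊕ ve
    vt≡ = trans (sym (⊕-cancelʳ (vec M t) ve)) (cong (_⊕ ve) (sym vg≡))
    g≢e : g ≢ e
    g≢e refl = nonzero M t (trans vt≡ (⊕-self ve))
    g<t : g < t
    g<t with <-cmp t g
    ... | tri< t<g _ _ = ⊥-elim (t≮g t<g)
    ... | tri≈ _ refl _ = ⊥-elim (nonzero M e (trans (sym (⊕-cancelˡ (vec M t) ve))
                                                     (trans (cong (vec M t ⊕_) (sym vg≡)) (⊕-self _))))
    ... | tri> _ _ g<t = g<t
    g-least : ∀ h → vec M h ≡ vec M g ⊕ ve → g < h
    g-least h vh≡ = subst (g <_) (distinct M (trans vt≡ (sym vh≡))) g<t
    project-partner : project (vec M g) ≡ project (vec M t)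
    project-partner = trans (cong project vg≡)
                        (trans (project-⊕ _ _) (trans (cong (project (vec M t) ⊕_) project-u) (⊕-identityʳ _)))

  representative-injective : ∀ {s t} → Representative s → Representative t → project (vec M s) ≡ project (vec M t) → s ≡ t
  representative-injective {s} {t} (_ , s-least) (_ , t-least) ps≡pt
    with project-kernel (vec M s ⊕ vec M t) (trans (project-⊕ _ _) (trans (cong (_ ⊕_) (sym ps≡pt)) (⊕-self _)))
  ... | inj₁ Σ≡0  = distinct M (⊕≡0⇒≡ Σ≡0)
  ... | inj₂ Σ≡ve = ⊥-elim (<-asym (s-least t (trans (sym (⊕-cancelˡ (vec M s) (vec M t))) (cong (vec M s ⊕_) Σ≡ve)))
                                   (t-least s (trans (sym (⊕-cancelʳ (vec M s) (vec M t)))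
                                                     (trans (cong (_⊕ vec M t) Σ≡ve) (⊕-comm ve (vec M t))))))

  rep : Fin (m M) → Fin (List.length representatives)
  rep t with t ≟ e
  ... | yes _   = index (proj₁ (proj₂ (class-representative d d≢e)))
  ... | no  t≢e = index (proj₁ (proj₂ (class-representative t t≢e)))

  lift-rep : ∀ t → t ≢ e → project (vec M (lift (rep t))) ≡ project (vec M t)
  lift-rep t t≢e with t ≟ e
  ... | yes t≡e = ⊥-elim (t≢e t≡e)
  ... | no  t≢e′ = let _ , r , eq = class-representative t t≢e′ in trans (cong (project ∘ vec M) (lift-index r)) eq

  contracted : SBM
  contracted = record
    { m        = List.length representatives
    ; n        = n M
    ; vec      = project ∘ vec M ∘ lift
    ; nonzero  = λ j p≡0 → [ nonzero M (lift j) , proj₁ (lift-representative j) ∘ distinct M ]′ (project-kernel _ p≡0)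
    ; distinct = λ eq → lift-injective (representative-injective (lift-representative _) (lift-representative _) eq)
    }

  contraction : LinearContraction contracted M e
  contraction = record
    { π        = project
    ; π-⊕      = project-⊕
    ; π-e      = project-u
    ; π-kernel = project-kernel
    ; rep      = rep
    ; π-rep    = λ t t≢e → sym (lift-rep t t≢e)
    ; lift     = lift
    ; lift-≢   = proj₁ ∘ lift-representative
    ; rep-lift = λ j → lift-injective (representative-injective (lift-representative _) (lift-representative j)
                                         (lift-rep (lift j) (proj₁ (lift-representative j))))
    }

  smaller : m contracted <ℕ m M
  smaller = subst (m contracted <ℕ_) (length-tabulate id)
              (filter-notAll representative? (allFin (m M)) (lose (∈-allFin e) λ r → proj₁ r refl))

-- K must be nonempty: a copy element serves as the image of each contracted element under rep
presentation⇒IndMinor : ∀ {K M ψ C} → Fin (m K) → LinearPresentation K M ψ C → IndMinor K M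
presentation⇒IndMinor {K} {M} i₀ = by-size M (<-wellFounded (m M))
  where
  by-size : ∀ M → Acc _<ℕ_ (m M) → ∀ {ψ C} → LinearPresentation K M ψ C → IndMinor K M
  by-size M (acc smaller-minors) {ψ} {C} P with nonempty? C
  ... | inj₂ C≐∅ = presentation-restriction P C≐∅
  ... | inj₁ (e , e∈C) =
    step (contr (LinearContraction.contraction-step contraction))
         (by-size contracted (smaller-minors smaller) (contract-presentation P e∈C contraction))
    where
    ψi₀≢e : ψ i₀ ≢ e
    ψi₀≢e ψi₀≡e = ∉⇒¬∈ (LinearPresentation.copy-∉ P i₀) (subst (_∈ C) (sym ψi₀≡e) e∈C)
    open CanonicalContraction M e (ψ i₀) ψi₀≢e

-- Circuits of a presented matroid

record IsCircuit (K : SBM) (Z : Subset (m K)) : Set where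
  constructor circuit
  field
    dependent             : ¬ Indep K Z
    deletions-independent : ∀ x → x ∈ Z → Indep K (Z ∖ ⁅ x ⁆)

module CopyCircuits {K M : SBM} (P : Presentation K M)
                    (circuit-through : ∀ i j → i ≢ j → ∃ λ Z → i ∈ Z × j ∈ Z × IsCircuit K Z)
                    (another : ∀ i → ∃ λ (j : Fin (m K)) → i ≢ j) where
  open Presentation P renaming (copy to ψ; contracted to C)

  private
    v = vec M

  C-indep : Indep M C
  C-indep = contracted-independent {K} {M} indep⇔

  circuit-collapse : ∀ {Z i} → IsCircuit K Z → i ∈ Z → ψ i ∈ (img ψ (Z ∖ ⁅ i ⁆) ∪ C) → ⊥
  circuit-collapse {Z} {i} (circuit Z-dep deletions-indep) i∈Z ψi∈ =
    Z-dep (from (indep⇔ Z) (Indep-mono v (∪-least ψZ⊆ (q⊆p∪q (img ψ (Z ∖ ⁅ i ⁆)) C))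
                                         (to (indep⇔ (Z ∖ ⁅ i ⁆)) (deletions-indep i i∈Z))))
    where
    ψZ⊆ : img ψ Z ⊆ (img ψ (Z ∖ ⁅ i ⁆) ∪ C)
    ψZ⊆ x x∈ with img⁻ ψ {Z} x∈
    ... | k , k∈Z , refl with k ≟ i
    ...   | yes refl = ψi∈
    ...   | no  k≢i  = p⊆p∪q (img ψ (Z ∖ ⁅ i ⁆)) C _ (img⁺ ψ {Z ∖ ⁅ i ⁆} (x∈p∖⁅y⁆ {X = Z} k∈Z k≢i) refl)

  ψ-injective : Injective _≡_ _≡_ ψ
  ψ-injective {i} {j} ψi≡ψj with i ≟ j
  ... | yes i≡j = i≡j
  ... | no  i≢j with circuit-through i j i≢j
  ...   | Z , i∈Z , j∈Z , Z-circuit =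
    ⊥-elim (circuit-collapse Z-circuit i∈Z (p⊆p∪q (img ψ (Z ∖ ⁅ i ⁆)) C _ ψi∈ψ[Z∖i]))
    where
    ψi∈ψ[Z∖i] : ψ i ∈ img ψ (Z ∖ ⁅ i ⁆)
    ψi∈ψ[Z∖i] = img⁺ ψ {Z ∖ ⁅ i ⁆} (x∈p∖⁅y⁆ {X = Z} j∈Z (i≢j ∘ sym)) (sym ψi≡ψj)

  ψ-∉ : ∀ i → ψ i ∉ C
  ψ-∉ i with circuit-through i (proj₁ (another i)) (proj₂ (another i))
  ... | Z , i∈Z , _ , Z-circuit =
    ¬∈⇒∉ λ ψi∈C → circuit-collapse Z-circuit i∈Z (q⊆p∪q (img ψ (Z ∖ ⁅ i ⁆)) C _ ψi∈C)

  lincomb-ψ : ∀ a → lincomb v (img ψ a) ≡ lincomb (v ∘ ψ) a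
  lincomb-ψ a = lincomb-img v ψ a λ _ _ → ψ-injective

  independent-mod-C : ∀ {X} → Indep K X → ∀ a → a ⊆ X → Span v C (lincomb (v ∘ ψ) a) → a ≐ ∅
  independent-mod-C {X} indX a a⊆X sp i = ¬∈⇒∉ λ i∈a → ∉⇒¬∈ (ψa≐∅ (ψ i)) (img⁺ ψ {a} i∈a refl)
    where
    ψX∩C≡∅ : Disjoint (img ψ X) C
    ψX∩C≡∅ j j∈ = let k , _ , ψk≡j = img⁻ ψ {X} j∈ in subst (_∉ C) ψk≡j (ψ-∉ k)
    ψa≐∅ : img ψ a ≐ ∅
    ψa≐∅ = Indep-∪⇒IndependentMod v (to (indep⇔ X) indX) ψX∩C≡∅ (img ψ a) (img-mono ψ {a} {X} a⊆X)
             (subst (Span v C) (sym (lincomb-ψ a)) sp)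

  -- a relation between the copy of Z and C involves all of Z, as Z minus any element is independent
  circuit-span : ∀ {Z} → IsCircuit K Z → Span v C (lincomb (v ∘ ψ) Z)
  circuit-span {Z} (circuit Z-dep deletions-indep) with Dep-∪⇒Span v C-indep (¬Indep⇒Dep v (Z-dep ∘ from (indep⇔ Z)))
  ... | a , a⊆ψZ , (x , x∈a) , spa = subst (Span v C) (lincomb-cong (v ∘ ψ) b≐Z) spb
    where
    b = a ∘ ψ
    spb : Span v C (lincomb (v ∘ ψ) b)
    spb = subst (Span v C) (trans (sym (lincomb-cong v (img-preimage ψ a (⊆-trans a⊆ψZ (img-mono ψ {Z} {full} ⊆-full)))))
                                  (lincomb-ψ b)) spa
    b⊆Z : b ⊆ Z
    b⊆Z k bk with img⁻ ψ {Z} (a⊆ψZ _ bk)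
    ... | l , l∈Z , ψl≡ψk = subst (_∈ Z) (ψ-injective ψl≡ψk) l∈Z
    b≢∅ : ¬ b ≐ ∅
    b≢∅ b≐∅ with img⁻ ψ {Z} (a⊆ψZ x x∈a)
    ... | k , _ , refl = ∉⇒¬∈ (b≐∅ k) x∈a
    Z⊆b : Z ⊆ b
    Z⊆b z z∈Z = decidable-stable (b z ≟ᵇ true) λ z∉b →
      b≢∅ (independent-mod-C (deletions-indep z z∈Z) b (λ k bk → x∈p∖⁅y⁆ {X = Z} (b⊆Z k bk) λ { refl → z∉b bk }) spb)
    b≐Z : b ≐ Z
    b≐Z = ⊆-antisym b⊆Z Z⊆b

-- M(K₄)

pattern e01 = zero
pattern e02 = suc zero
pattern e03 = suc (suc zero)
pattern e12 = suc (suc (suc zero))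
pattern e13 = suc (suc (suc (suc zero)))
pattern e23 = suc (suc (suc (suc (suc zero))))

edges : Bool → Bool → Bool → Bool → Bool → Bool → Subset 6
edges b01 b02 b03 b12 b13 b23 e01 = b01
edges b01 b02 b03 b12 b13 b23 e02 = b02
edges b01 b02 b03 b12 b13 b23 e03 = b03
edges b01 b02 b03 b12 b13 b23 e12 = b12
edges b01 b02 b03 b12 b13 b23 e13 = b13
edges b01 b02 b03 b12 b13 b23 e23 = b23

triangle₀₁₂ triangle₀₁₃ triangle₀₂₃ triangle₁₂₃ square₀₁₃₂ square₀₂₁₃ star₀ : Subset 6
triangle₀₁₂ = edges true  true  false true  false false
triangle₀₁₃ = edges true  false true  false true  false
triangle₀₂₃ = edges false true  true  false false true
triangle₁₂₃ = edges false false false true  true  true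
square₀₁₃₂  = edges true  true  false false true  true
square₀₂₁₃  = edges false true  true  true  true  false
star₀       = edges true  true  true  false false false

circuit? : ∀ Z → Dec (IsCircuit MK4 Z)
circuit? Z = map′ (λ (dep , del) → circuit dep del) (λ (circuit dep del) → dep , del)
  (¬? (independent? K4edge Z) ×-dec all? λ x → (Z x ≟ᵇ true) →-dec independent? K4edge (Z ∖ ⁅ x ⁆))

cycles : List (Subset 6)
cycles = triangle₀₁₂ ∷ triangle₀₁₃ ∷ triangle₀₂₃ ∷ triangle₁₂₃ ∷ square₀₁₃₂ ∷ square₀₂₁₃ ∷ []

cycles-are-circuits : All (IsCircuit MK4) cycles
cycles-are-circuits = toWitness {a? = All.all? circuit? cycles} tt

pairs-lie-on-cycles : ∀ i j → i ≢ j → Any (λ Z → i ∈ Z × j ∈ Z) cycles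
pairs-lie-on-cycles =
  toWitness {a? = all? λ i → all? λ j → ¬? (i ≟ j) →-dec Any.any? (λ Z → (Z i ≟ᵇ true) ×-dec (Z j ≟ᵇ true)) cycles} tt

circuit-through : ∀ i j → i ≢ j → ∃ λ Z → i ∈ Z × j ∈ Z × IsCircuit MK4 Z
circuit-through i j i≢j = let Z , Z∈ , i∈Z , j∈Z = find (pairs-lie-on-cycles i j i≢j) in
                          Z , i∈Z , j∈Z , All.lookup cycles-are-circuits Z∈

star₀-indep : Indep MK4 star₀
star₀-indep = toWitness {a? = independent? K4edge star₀} tt

another-edge : ∀ (i : Fin 6) → ∃ λ j → i ≢ j
another-edge zero    = e02 , λ ()
another-edge (suc _) = e01 , λ ()

-- Each edge outside the star at 0 closes exactly one of the triangles through 0; adding those triangles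
-- rewrites any set of edges as a subset of the star with the same boundary.
triangle-part : Subset 6 → Subset 6
triangle-part a = (a e12 ·ₛ triangle₀₁₂) ⊻ (a e13 ·ₛ triangle₀₁₃) ⊻ (a e23 ·ₛ triangle₀₂₃)

reduce : Subset 6 → Subset 6
reduce a = a ⊻ triangle-part a

reduce-⊆ : ∀ a → reduce a ⊆ star₀
reduce-⊆ a e01 _ = refl
reduce-⊆ a e02 _ = refl
reduce-⊆ a e03 _ = refl
reduce-⊆ a e12 h rewrite ∧-identityʳ (a e12) | ∧-zeroʳ (a e13) | ∧-zeroʳ (a e23) | xor-identityʳ (a e12) | xor-same (a e12) = h
reduce-⊆ a e13 h rewrite ∧-zeroʳ (a e12) | ∧-identityʳ (a e13) | ∧-zeroʳ (a e23) | xor-identityʳ (a e13) | xor-same (a e13) = h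
reduce-⊆ a e23 h rewrite ∧-zeroʳ (a e12) | ∧-zeroʳ (a e13) | ∧-identityʳ (a e23) | xor-same (a e23) = h

lincomb-reduce : ∀ {n} (v : Fin 6 → Vec Bool n) a → lincomb v a ⊕ lincomb v (reduce a) ≡ lincomb v (triangle-part a)
lincomb-reduce v a = trans (cong (lincomb v a ⊕_) (lincomb-⊻ v a (triangle-part a))) (⊕-cancelˡ _ _)

lincomb-triangle-part : ∀ {n} (v : Fin 6 → Vec Bool n) a →
  lincomb v (triangle-part a) ≡
  a e12 · lincomb v triangle₀₁₂ ⊕ (a e13 · lincomb v triangle₀₁₃ ⊕ a e23 · lincomb v triangle₀₂₃)
lincomb-triangle-part v a
  rewrite lincomb-⊻ v (a e12 ·ₛ triangle₀₁₂) ((a e13 ·ₛ triangle₀₁₃) ⊻ (a e23 ·ₛ triangle₀₂₃))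
        | lincomb-⊻ v (a e13 ·ₛ triangle₀₁₃) (a e23 ·ₛ triangle₀₂₃)
        | lincomb-·ₛ v (a e12) triangle₀₁₂ | lincomb-·ₛ v (a e13) triangle₀₁₃
        | lincomb-·ₛ v (a e23) triangle₀₂₃ = refl

K4-reduce : ∀ a → lincomb K4edge a ≡ lincomb K4edge (reduce a)
K4-reduce a = ⊕≡0⇒≡ (trans (lincomb-reduce K4edge a) (trans (lincomb-triangle-part K4edge a)
  (cong₂ _⊕_ (·-zeroV (a e12)) (cong₂ _⊕_ (·-zeroV (a e13)) (·-zeroV (a e23))))))

module _ {M : SBM} (P : Presentation MK4 M) where
  open Presentation P renaming (copy to ψ; contracted to C)
  open CopyCircuits P circuit-through another-edge
  private
    v = vec M

    triangle-part-span : ∀ a → Span v C (lincomb (v ∘ ψ) (triangle-part a))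
    triangle-part-span a = subst (Span v C) (sym (lincomb-triangle-part (v ∘ ψ) a))
      (span-⊕ (span-· (a e12) (circuit-span {triangle₀₁₂} (All.lookup cycles-are-circuits (Any.here refl))))
        (span-⊕ (span-· (a e13) (circuit-span {triangle₀₁₃} (All.lookup cycles-are-circuits (Any.there (Any.here refl)))))
                (span-· (a e23) (circuit-span {triangle₀₂₃} (All.lookup cycles-are-circuits (Any.there (Any.there (Any.here refl))))))))

    reduce-span : ∀ a w → Span v C (w ⊕ lincomb (v ∘ ψ) a) → Span v C (w ⊕ lincomb (v ∘ ψ) (reduce a))
    reduce-span a w sp = subst (Span v C) eq (span-⊕ sp (triangle-part-span a))
      where
      eq : (w ⊕ lincomb (v ∘ ψ) a) ⊕ lincomb (v ∘ ψ) (triangle-part a) ≡ w ⊕ lincomb (v ∘ ψ) (reduce a)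
      eq = trans (⊕-assoc w (lincomb (v ∘ ψ) a) _) (cong (w ⊕_) (sym (lincomb-⊻ (v ∘ ψ) a (triangle-part a))))

  linear-presentation : LinearPresentation MK4 M ψ C
  linear-presentation = record
    { contracted-indep = C-indep
    ; span⇔cycle       = λ a → mk⇔ (span⇒cycle a) (cycle⇒span a)
    ; closed           = closed′
    }
    where
    span⇒cycle : ∀ a → Span v C (lincomb (v ∘ ψ) a) → lincomb K4edge a ≡ zeroV
    span⇒cycle a sp = trans (K4-reduce a) (lincomb-∅ K4edge (independent-mod-C star₀-indep (reduce a) (reduce-⊆ a)
      (subst (Span v C) (⊕-identityˡ _) (reduce-span a zeroV (subst (Span v C) (sym (⊕-identityˡ _)) sp)))))
    cycle⇒span : ∀ a → lincomb K4edge a ≡ zeroV → Span v C (lincomb (v ∘ ψ) a)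
    cycle⇒span a cycle = subst (Span v C) Σtp≡Σa (triangle-part-span a)
      where
      reduce≐∅ : reduce a ≐ ∅
      reduce≐∅ = star₀-indep (reduce a) (reduce-⊆ a) (trans (sym (K4-reduce a)) cycle)
      Σtp≡Σa : lincomb (v ∘ ψ) (triangle-part a) ≡ lincomb (v ∘ ψ) a
      Σtp≡Σa = trans (sym (lincomb-reduce (v ∘ ψ) a))
                     (trans (cong (lincomb (v ∘ ψ) a ⊕_) (lincomb-∅ (v ∘ ψ) reduce≐∅)) (⊕-identityʳ _))
    closed′ : ∀ f → Span v (img ψ full ∪ C) (v f) → SpanLoopOrParallel M ψ C f
    closed′ f sp = LoopOrParallel⇒span {M} C-indep (contracted-copy-independent {MK4} {M} indep⇔)
                     (closed (img-mono ψ {star₀} {full} ⊆-full) (to (indep⇔ star₀) star₀-indep)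
                             (Span⇒InClosure v f∈⟨ψstar∪C⟩))
      where
      b = proj₁ (span-img-∪⁻ v ψ-injective sp)
      spr : Span v C (v f ⊕ lincomb (v ∘ ψ) (reduce b))
      spr = reduce-span b (v f) (subst (Span v C) (⊕-comm (lincomb (v ∘ ψ) b) (v f)) (proj₂ (span-img-∪⁻ v ψ-injective sp)))
      f∈⟨ψstar∪C⟩ : Span v (img ψ star₀ ∪ C) (v f)
      f∈⟨ψstar∪C⟩ = subst (Span v _) (⊕-cancelʳ (v f) (lincomb (v ∘ ψ) (reduce b)))
        (span-⊕ (span-mono (q⊆p∪q (img ψ star₀) C) spr)
                (span-mono (p⊆p∪q (img ψ star₀) C)
                  (spanned-by (img ψ (reduce b)) (img-mono ψ {reduce b} {star₀} (reduce-⊆ b)) (lincomb-ψ (reduce b)))))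

all-ones : Vec Bool 4
all-ones = true ∷ true ∷ true ∷ true ∷ []

opposite : Fin 6 → Fin 6
opposite e01 = e23
opposite e02 = e13
opposite e03 = e12
opposite e12 = e03
opposite e13 = e02
opposite e23 = e01

edge⊕opposite : ∀ k → K4edge k ⊕ K4edge (opposite k) ≡ all-ones
edge⊕opposite e01 = refl
edge⊕opposite e02 = refl
edge⊕opposite e03 = refl
edge⊕opposite e12 = refl
edge⊕opposite e13 = refl
edge⊕opposite e23 = refl

edge≢all-ones : ∀ k → K4edge k ≢ all-ones
edge≢all-ones e01 ()
edge≢all-ones e02 ()
edge≢all-ones e03 ()
edge≢all-ones e12 ()
edge≢all-ones e13 ()
edge≢all-ones e23 ()

parity : ∀ {n} → Vec Bool n → Bool
parity = foldr _ _xor_ false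

parity-⊕ : ∀ {n} (u w : Vec Bool n) → parity (u ⊕ w) ≡ parity u xor parity w
parity-⊕ []      []      = refl
parity-⊕ (a ∷ u) (b ∷ w) rewrite parity-⊕ u w =
  solve 4 (λ a b c d → (a :+ b) :+ (c :+ d) := (a :+ c) :+ (b :+ d)) refl a b (parity u) (parity w)
  where open xor-∧-Solver using (solve; _:=_; _:+_)

-- every sum of edges of K₄ has even weight, and the even-weight vectors of GF(2)⁴ are 0, 1111 and the edges
K4-sum-cases : ∀ a → lincomb K4edge a ≡ zeroV ⊎ lincomb K4edge a ≡ all-ones ⊎ ∃ λ k → lincomb K4edge a ≡ K4edge k
K4-sum-cases a = even-cases (lincomb K4edge a)
  (trans (sym (lincomb-map (λ u → parity u ∷ []) (λ u w → cong (_∷ []) (parity-⊕ u w)) refl K4edge a)) (lincomb-∅-vec a))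
  where
  edge-even : ∀ i → parity (K4edge i) ∷ [] ≡ zeroV
  edge-even e01 = refl
  edge-even e02 = refl
  edge-even e03 = refl
  edge-even e12 = refl
  edge-even e13 = refl
  edge-even e23 = refl
  lincomb-∅-vec : ∀ a → lincomb (λ i → parity (K4edge i) ∷ []) a ≡ zeroV
  lincomb-∅-vec a = trans (lincomb-cong-on a λ i _ → edge-even i) (lincomb-0 a)
  even-cases : ∀ w → parity w ∷ [] ≡ false ∷ [] → w ≡ zeroV ⊎ w ≡ all-ones ⊎ ∃ λ k → w ≡ K4edge k
  even-cases (false ∷ false ∷ false ∷ false ∷ []) _ = inj₁ refl
  even-cases (true ∷ true ∷ true ∷ true ∷ []) _ = inj₂ (inj₁ refl)
  even-cases (true ∷ true ∷ false ∷ false ∷ []) _ = inj₂ (inj₂ (e01 , refl))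
  even-cases (true ∷ false ∷ true ∷ false ∷ []) _ = inj₂ (inj₂ (e02 , refl))
  even-cases (true ∷ false ∷ false ∷ true ∷ []) _ = inj₂ (inj₂ (e03 , refl))
  even-cases (false ∷ true ∷ true ∷ false ∷ []) _ = inj₂ (inj₂ (e12 , refl))
  even-cases (false ∷ true ∷ false ∷ true ∷ []) _ = inj₂ (inj₂ (e13 , refl))
  even-cases (false ∷ false ∷ true ∷ true ∷ []) _ = inj₂ (inj₂ (e23 , refl))
  even-cases (true ∷ false ∷ false ∷ false ∷ []) ()
  even-cases (false ∷ true ∷ false ∷ false ∷ []) ()
  even-cases (false ∷ false ∷ true ∷ false ∷ []) ()
  even-cases (false ∷ false ∷ false ∷ true ∷ []) ()
  even-cases (true ∷ true ∷ true ∷ false ∷ []) ()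
  even-cases (true ∷ true ∷ false ∷ true ∷ []) ()
  even-cases (true ∷ false ∷ true ∷ true ∷ []) ()
  even-cases (false ∷ true ∷ true ∷ true ∷ []) ()

-- the witness is the edge opposite to the sum
opposite-edge-avoids : ∀ a → lincomb K4edge a ≢ zeroV → lincomb K4edge a ≢ all-ones →
                       ∃ λ k → K4edge k ≢ lincomb K4edge a × ∀ j → K4edge k ⊕ K4edge j ≢ lincomb K4edge a
opposite-edge-avoids a Σa≢0 Σa≢1111 with K4-sum-cases a
... | inj₁ Σa≡0                = ⊥-elim (Σa≢0 Σa≡0)
... | inj₂ (inj₁ Σa≡1111)      = ⊥-elim (Σa≢1111 Σa≡1111)
... | inj₂ (inj₂ (k₀ , Σa≡k₀)) = opposite k₀ , not-k₀ , not-completed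
  where
  k = opposite k₀
  not-k₀ : K4edge k ≢ lincomb K4edge a
  not-k₀ k≡ with trans (sym (edge⊕opposite k₀)) (trans (cong (K4edge k₀ ⊕_) (trans k≡ Σa≡k₀)) (⊕-self (K4edge k₀)))
  ... | ()
  not-completed : ∀ j → K4edge k ⊕ K4edge j ≢ lincomb K4edge a
  not-completed j k⊕j≡ = edge≢all-ones j (begin
    K4edge j                          ≡⟨ ⊕-cancelˡ (K4edge k) (K4edge j) ⟨
    K4edge k ⊕ (K4edge k ⊕ K4edge j)  ≡⟨ cong (K4edge k ⊕_) (trans k⊕j≡ Σa≡k₀) ⟩
    K4edge k ⊕ K4edge k₀              ≡⟨ ⊕-comm (K4edge k) (K4edge k₀) ⟩
    K4edge k₀ ⊕ K4edge k              ≡⟨ edge⊕opposite k₀ ⟩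
    all-ones                          ∎)
    where open ≡-Reasoning

matching : Subset 6
matching = edges true false false false false true

-- The cone and its tip

infixr 5 _∷ₛ_

_∷ₛ_ : ∀ {m} → Bool → Subset m → Subset (suc m)
(b ∷ₛ S) zero    = b
(b ∷ₛ S) (suc i) = S i

-- A(N): the tipless cone A(N)\p with the tip p added as element 0.
module Cone (N : SBM) where

  tipless : SBM
  tipless = TiplessCone N

  tip : Vec Bool (suc (n N))
  tip = true ∷ zeroV

  base : Fin (m tipless) → Fin (m N)
  base x = [ id , id ]′ (splitAt (m N) x)

  tail-vec : ∀ x → tail (vec tipless x) ≡ vec N (base x)
  tail-vec x with splitAt (m N) x
  ... | inj₁ i = refl
  ... | inj₂ i = refl

  -- the third point on the line through the tip and x
  partner : Fin (m tipless) → Fin (m tipless)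
  partner x = join (m N) (m N) (swap (splitAt (m N) x))

  vec-partner : ∀ x → vec tipless (partner x) ≡ tip ⊕ vec tipless x
  vec-partner x rewrite splitAt-join (m N) (m N) (swap (splitAt (m N) x)) with splitAt (m N) x
  ... | inj₁ i = cong (true ∷_) (sym (⊕-identityˡ (vec N i)))
  ... | inj₂ i = cong (false ∷_) (sym (⊕-identityˡ (vec N i)))

  tip≢ : ∀ x → tip ≢ vec tipless x
  tip≢ x tip≡ = nonzero N (base x) (trans (sym (tail-vec x)) (sym (cong tail tip≡)))

  cone-vec : Fin (suc (m tipless)) → Vec Bool (suc (n N))
  cone-vec zero    = tip
  cone-vec (suc x) = vec tipless x

  cone : SBM
  cone = record
    { m        = suc (m tipless)
    ; n        = suc (n N)
    ; vec      = cone-vec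
    ; nonzero  = λ { zero () ; (suc x) → nonzero tipless x }
    ; distinct = λ { {zero} {zero} _ → refl
                   ; {zero} {suc y} eq → ⊥-elim (tip≢ y eq)
                   ; {suc x} {zero} eq → ⊥-elim (tip≢ x (sym eq))
                   ; {suc x} {suc y} eq → cong suc (distinct tipless eq) }
    }

  tail-⊕ : ∀ (u w : Vec Bool (suc (n N))) → tail (u ⊕ w) ≡ tail u ⊕ tail w
  tail-⊕ (a ∷ u) (b ∷ w) = refl

  tail-kernel : ∀ w → tail w ≡ zeroV → w ≡ zeroV ⊎ w ≡ tip
  tail-kernel (false ∷ w) refl = inj₁ refl
  tail-kernel (true  ∷ w) refl = inj₂ refl

  -- N = si(A(N) / p); d is the image of the tip under rep
  cone-contraction : Fin (m N) → LinearContraction N cone zero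
  cone-contraction d = record
    { π        = tail
    ; π-⊕      = tail-⊕
    ; π-e      = refl
    ; π-kernel = tail-kernel
    ; rep      = λ { zero → d ; (suc x) → base x }
    ; π-rep    = λ { zero 0≢0 → ⊥-elim (0≢0 refl) ; (suc x) _ → tail-vec x }
    ; lift     = λ j → suc (j ↑ˡ m N)
    ; lift-≢   = λ _ ()
    ; rep-lift = λ j → cong [ id , id ]′ (splitAt-↑ˡ (m N) j (m N))
    }

  embed : Fin (m tipless) → Fin (m cone)
  embed = suc

  lincomb-cone : ∀ b d → lincomb (vec cone) (b ∷ₛ d) ≡ b · tip ⊕ lincomb (vec tipless) d
  lincomb-cone b d = lincomb-suc (vec cone) (b ∷ₛ d)

  cone-span⁺ : ∀ {b A w} → Span (vec tipless) A w → Span (vec cone) (b ∷ₛ A) w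
  cone-span⁺ {b} (spanned-by d d⊆A Σd≡w) =
    spanned-by (false ∷ₛ d) (λ { (suc i) h → d⊆A i h }) (trans (lincomb-cone false d) (trans (⊕-identityˡ _) Σd≡w))

  cone-span⁺-tip : ∀ {A w} → Span (vec tipless) A (w ⊕ tip) → Span (vec cone) (true ∷ₛ A) w
  cone-span⁺-tip {A} {w} sp = subst (Span (vec cone) _) (⊕-cancelʳ w tip) (span-⊕ (cone-span⁺ sp) (span-∈ {i = zero} refl))

  cone-span⁻ : ∀ {b A w} → Span (vec cone) (b ∷ₛ A) w → Span (vec tipless) A w ⊎ Span (vec tipless) A (w ⊕ tip)
  cone-span⁻ {b} {A} {w} (spanned-by d d⊆ Σd≡w) = by-tip-coefficient (d zero) refl
    where
    d′ = d ∘ suc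
    d′⊆A : d′ ⊆ A
    d′⊆A i = d⊆ (suc i)
    Σd≡ : ∀ {x} → d zero ≡ x → x · tip ⊕ lincomb (vec tipless) d′ ≡ w
    Σd≡ d0 = trans (cong (λ x → x · tip ⊕ lincomb (vec tipless) d′) (sym d0)) (trans (sym (lincomb-suc (vec cone) d)) Σd≡w)
    by-tip-coefficient : ∀ x → d zero ≡ x → Span (vec tipless) A w ⊎ Span (vec tipless) A (w ⊕ tip)
    by-tip-coefficient false d0 = inj₁ (spanned-by d′ d′⊆A (trans (sym (⊕-identityˡ _)) (Σd≡ d0)))
    by-tip-coefficient true  d0 = inj₂ (spanned-by d′ d′⊆A (⊕≡⇒≡⊕ (trans (⊕-comm _ tip) (Σd≡ d0))))

  Indep-cone : ∀ {A} → Indep tipless A → ¬ Span (vec tipless) A tip → Indep cone (true ∷ₛ A)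
  Indep-cone {A} indA tip∉⟨A⟩ c c⊆ Σc≡0 = by-tip-coefficient (c zero) refl
    where
    c′ = c ∘ suc
    c′⊆A : c′ ⊆ A
    c′⊆A i = c⊆ (suc i)
    Σc≡ : ∀ {x} → c zero ≡ x → x · tip ⊕ lincomb (vec tipless) c′ ≡ zeroV
    Σc≡ c0 = trans (cong (λ x → x · tip ⊕ lincomb (vec tipless) c′) (sym c0)) (trans (sym (lincomb-suc (vec cone) c)) Σc≡0)
    by-tip-coefficient : ∀ x → c zero ≡ x → ∀ i → c i ≡ false
    by-tip-coefficient true  c0 = ⊥-elim (tip∉⟨A⟩ (spanned-by c′ c′⊆A (sym (⊕≡0⇒≡ (Σc≡ c0)))))
    by-tip-coefficient false c0 zero    = c0
    by-tip-coefficient false c0 (suc i) = indA c′ c′⊆A (trans (sym (⊕-identityˡ _)) (Σc≡ c0)) i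

  img-embed : ∀ {k} (ψ : Fin k → Fin (m tipless)) X b A → img (embed ∘ ψ) X ∪ (b ∷ₛ A) ≐ b ∷ₛ (img ψ X ∪ A)
  img-embed ψ X b A zero    = cong (_∨ b) (img-∉ (embed ∘ ψ) {X} {zero} λ _ _ ())
  img-embed ψ X b A (suc j) = cong (_∨ A j) (⊆-antisym {X = λ (_ : Fin 1) → img (embed ∘ ψ) X (suc j)} {Y = λ _ → img ψ X j}
    (λ _ h → let i , i∈X , sψi≡sj = img⁻ (embed ∘ ψ) {X} h in img⁺ ψ {X} i∈X (suc-injective sψi≡sj))
    (λ _ h → let i , i∈X , ψi≡j = img⁻ ψ {X} h in img⁺ (embed ∘ ψ) {X} i∈X (cong suc ψi≡j)) zero)

module TipPosition (N : SBM) {ψ : Fin 6 → Fin (m (TiplessCone N))} {C : Subset (m (TiplessCone N))}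
                (P : LinearPresentation MK4 (TiplessCone N) ψ C) where
  open Cone N
  open LinearPresentation P

  private
    v = vec tipless
    Q = img ψ full ∪ C

  ConePresentation : Set
  ConePresentation = ∃ λ C′ → LinearPresentation MK4 cone (embed ∘ ψ) (true ∷ₛ C′)

  tip-outside : ¬ Span v Q tip → ConePresentation
  tip-outside tip∉⟨Q⟩ = C , record
    { contracted-indep = Indep-cone contracted-indep (tip∉⟨Q⟩ ∘ span-mono (q⊆p∪q (img ψ full) C))
    ; span⇔cycle       = λ a → span⇔cycle a ⇔-∘ mk⇔ (drop-tip a) cone-span⁺
    ; closed           = closed′
    }
    where
    drop-tip : ∀ a → Span (vec cone) (true ∷ₛ C) (lincomb (v ∘ ψ) a) → Span v C (lincomb (v ∘ ψ) a)
    drop-tip a sp = [ id , (λ p → ⊥-elim (tip∉⟨Q⟩ (subst (Span v Q) (⊕-cancelˡ (lincomb (v ∘ ψ) a) tip)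
                                            (span-⊕ (span-copy a) (span-mono (q⊆p∪q (img ψ full) C) p))))) ]′ (cone-span⁻ sp)
    closed′ : ∀ f → Span (vec cone) (img (embed ∘ ψ) full ∪ (true ∷ₛ C)) (vec cone f) →
              SpanLoopOrParallel cone (embed ∘ ψ) (true ∷ₛ C) f
    closed′ zero    _  = inj₁ (span-∈ {i = zero} refl)
    closed′ (suc x) sp with cone-span⁻ (span-mono (≐⇒⊆ (img-embed ψ full true C)) sp)
    ... | inj₁ x∈⟨Q⟩ = [ inj₁ ∘ cone-span⁺ , (λ (i , p) → inj₂ (i , cone-span⁺ p)) ]′ (closed x x∈⟨Q⟩)
    ... | inj₂ x⊕tip∈⟨Q⟩
      with closed (partner x) (subst (Span v Q) (trans (⊕-comm (v x) tip) (sym (vec-partner x))) x⊕tip∈⟨Q⟩)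
    ...   | inj₁ p       = inj₁ (cone-span⁺-tip (subst (Span v C) (trans (vec-partner x) (⊕-comm tip (v x))) p))
    ...   | inj₂ (i , p) = inj₂ (i , cone-span⁺-tip (subst (Span v C) partner-sum p))
      where
      partner-sum : v (partner x) ⊕ v (ψ i) ≡ (v x ⊕ v (ψ i)) ⊕ tip
      partner-sum = trans (cong (_⊕ v (ψ i)) (vec-partner x)) (⊕-rotate tip (v x) (v (ψ i)))

  -- the tip, spanned by d ⊆ C, takes the place of an element c₀ of d
  module TipExchange {d : Subset (m tipless)} (d⊆C : d ⊆ C) (Σd≡tip : lincomb v d ≡ tip) {c₀} (c₀∈d : c₀ ∈ d) where

    C′ : Subset (m tipless)
    C′ = C ∖ ⁅ c₀ ⁆

    C′⊆C : C′ ⊆ C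
    C′⊆C = p∖q⊆p C ⁅ c₀ ⁆

    avoid-c₀ : ∀ {A X} → X ⊆ (A ∪ C) → c₀ ∉ X → X ⊆ (A ∪ C′)
    avoid-c₀ {A} {X} X⊆ c₀∉X x x∈X with x∈p∪q⁻ A C (X⊆ x x∈X)
    ... | inj₁ x∈A = p⊆p∪q A C′ x x∈A
    ... | inj₂ x∈C = q⊆p∪q A C′ x (x∈p∖⁅y⁆ {X = C} x∈C λ { refl → ∉⇒¬∈ c₀∉X x∈X })

    exchange⁺ : ∀ A {w} → Span v (A ∪ C) w → Span (vec cone) (true ∷ₛ (A ∪ C′)) w
    exchange⁺ A {w} (spanned-by e e⊆ Σe≡w) with e c₀ in ec₀
    ... | false = cone-span⁺ (spanned-by e (avoid-c₀ {A} e⊆ ec₀) Σe≡w)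
    ... | true  = cone-span⁺-tip (spanned-by (e ⊻ d) (avoid-c₀ {A} (⊻-⊆ e⊆ (⊆-trans d⊆C (q⊆p∪q A C))) c₀∉e⊻d)
                                             (trans (lincomb-⊻ v e d) (cong₂ _⊕_ Σe≡w Σd≡tip)))
      where
      c₀∉e⊻d : (e ⊻ d) c₀ ≡ false
      c₀∉e⊻d rewrite ec₀ | c₀∈d = refl

    exchange⁻ : ∀ A {w} → Span (vec cone) (true ∷ₛ (A ∪ C′)) w → Span v (A ∪ C) w
    exchange⁻ A {w} sp with cone-span⁻ sp
    ... | inj₁ p = span-mono (∪-monoʳ A C′⊆C) p
    ... | inj₂ p = subst (Span v (A ∪ C)) (⊕-cancelʳ w tip)
                     (span-⊕ (span-mono (∪-monoʳ A C′⊆C) p) (span-mono (q⊆p∪q A C) (spanned-by d d⊆C Σd≡tip)))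

    tip∉⟨C′⟩ : ¬ Span v C′ tip
    tip∉⟨C′⟩ (spanned-by e e⊆C′ Σe≡tip) =
      ∉⇒¬∈ (contracted-indep (e ⊻ d) (⊻-⊆ (⊆-trans e⊆C′ C′⊆C) d⊆C)
                               (trans (lincomb-⊻ v e d) (trans (cong₂ _⊕_ Σe≡tip Σd≡tip) (⊕-self tip))) c₀)
           c₀∈e⊻d
      where
      c₀∈e⊻d : (e ⊻ d) c₀ ≡ true
      c₀∉e : e c₀ ≡ false
      c₀∉e = ¬∈⇒∉ λ c₀∈e → ∉⇒¬∈ (p∖q-disjoint C ⁅ c₀ ⁆ c₀ (e⊆C′ c₀ c₀∈e)) (x∈⁅x⁆ c₀)
      c₀∈e⊻d rewrite c₀∉e | c₀∈d = refl

    cone-presentation : LinearPresentation MK4 cone (embed ∘ ψ) (true ∷ₛ C′)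
    cone-presentation = record
      { contracted-indep = Indep-cone (Indep-mono v C′⊆C contracted-indep) tip∉⟨C′⟩
      ; span⇔cycle       = λ a → span⇔cycle a ⇔-∘ mk⇔ (exchange⁻ ∅) (exchange⁺ ∅)
      ; closed           = closed′
      }
      where
      closed′ : ∀ f → Span (vec cone) (img (embed ∘ ψ) full ∪ (true ∷ₛ C′)) (vec cone f) →
                SpanLoopOrParallel cone (embed ∘ ψ) (true ∷ₛ C′) f
      closed′ zero    _  = inj₁ (span-∈ {i = zero} refl)
      closed′ (suc x) sp = [ inj₁ ∘ exchange⁺ ∅ , (λ (i , p) → inj₂ (i , exchange⁺ ∅ p)) ]′
                             (closed x (exchange⁻ (img ψ full) (span-mono (≐⇒⊆ (img-embed ψ full true C′)) sp)))

  tip-in-⟨C⟩ : Span v C tip → ConePresentation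
  tip-in-⟨C⟩ (spanned-by d d⊆C Σd≡tip) with nonempty? d
  ... | inj₁ (c₀ , c₀∈d) = _ , TipExchange.cone-presentation d⊆C Σd≡tip c₀∈d
  ... | inj₂ d≐∅ with trans (sym Σd≡tip) (lincomb-∅ v d≐∅)
  ...   | ()

  Triangle-in-N : Set
  Triangle-in-N = ∃ λ i → ∃ λ j → ∃ λ k → Triangle N i j k

  -- Comparing the tip with the partners of the copy shows that modulo ⟨C⟩ it is the sum of a perfect
  -- matching of the copy; then C is empty, and a triangle of the copy projects from the tip onto one of N.
  module TipBetween (tip∈⟨Q⟩ : Span v Q tip) (tip∉⟨C⟩ : ¬ Span v C tip) where

    Σψ : Subset 6 → Vec Bool (suc (n N))
    Σψ = lincomb (v ∘ ψ)

    cycle : ∀ a → Span v C (Σψ a) → lincomb K4edge a ≡ zeroV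
    cycle a = to (span⇔cycle a)

    combine : ∀ {x y z} → Span v C (x ⊕ y) → Span v C (x ⊕ z) → Span v C (y ⊕ z)
    combine {x} {y} {z} p q = subst (Span v C) (⊕-cancel-common x y z) (span-⊕ p q)

    b : Subset 6
    b = proj₁ (span-copy-∪⁻ tip∈⟨Q⟩)

    tip⊕Σb : Span v C (tip ⊕ Σψ b)
    tip⊕Σb = subst (Span v C) (⊕-comm (Σψ b) tip) (proj₂ (span-copy-∪⁻ tip∈⟨Q⟩))

    partner-closed : ∀ x → x ∈ Q → Span v C (tip ⊕ v x) ⊎ ∃ λ j → Span v C (tip ⊕ (v x ⊕ v (ψ j)))
    partner-closed x x∈Q with closed (partner x) (subst (Span v Q) (sym (vec-partner x)) (span-⊕ tip∈⟨Q⟩ (span-∈ x∈Q)))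
    ... | inj₁ p       = inj₁ (subst (Span v C) (vec-partner x) p)
    ... | inj₂ (j , p) = inj₂ (j , subst (Span v C) (trans (cong (_⊕ v (ψ j)) (vec-partner x)) (⊕-assoc tip (v x) (v (ψ j)))) p)

    K4Σb≢0 : lincomb K4edge b ≢ zeroV
    K4Σb≢0 cyc = tip∉⟨C⟩ (subst (Span v C) (⊕-cancelʳ tip (Σψ b)) (span-⊕ tip⊕Σb (from (span⇔cycle b) cyc)))

    copy-partner-cycles : ∀ k → K4edge k ≡ lincomb K4edge b ⊎ ∃ λ j → K4edge k ⊕ K4edge j ≡ lincomb K4edge b
    copy-partner-cycles k with partner-closed (ψ k) (p⊆p∪q (img ψ full) C (ψ k) (img⁺ ψ {full} refl refl))
    ... | inj₁ p       = inj₁ (⊕≡0⇒≡ (trans (sym (lincomb-⁅⁆⊻ K4edge k b))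
                           (cycle (⁅ k ⁆ ⊻ b) (subst (Span v C) (sym (lincomb-⁅⁆⊻ (v ∘ ψ) k b)) (combine p tip⊕Σb)))))
    ... | inj₂ (j , p) = inj₂ (j , ⊕≡0⇒≡ (trans (sym (lincomb-pair⊻ K4edge k j b))
                           (cycle ((⁅ k ⁆ ⊻ ⁅ j ⁆) ⊻ b)
                                  (subst (Span v C) (sym (lincomb-pair⊻ (v ∘ ψ) k j b)) (combine p tip⊕Σb)))))

    K4Σb≡1111 : lincomb K4edge b ≡ all-ones
    K4Σb≡1111 = decidable-stable (lincomb K4edge b ≟ᵛ all-ones) λ K4Σb≢1111 →
      let k , k≢ , k⊕j≢ = opposite-edge-avoids b K4Σb≢0 K4Σb≢1111 in
      [ k≢ , (λ (j , k⊕j≡) → k⊕j≢ j k⊕j≡) ]′ (copy-partner-cycles k)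

    tip⊕Σm : Span v C (tip ⊕ Σψ matching)
    tip⊕Σm = combine (subst (Span v C) (⊕-comm tip (Σψ b)) tip⊕Σb)
               (subst (Span v C) (lincomb-⊻ (v ∘ ψ) b matching)
                 (from (span⇔cycle (b ⊻ matching)) (trans (lincomb-⊻ K4edge b matching) (cong (_⊕ all-ones) K4Σb≡1111))))

    C≐∅ : C ≐ ∅
    C≐∅ x = ¬∈⇒∉ λ x∈C →
      [ (λ p → tip∉⟨C⟩ (subst (Span v C) (⊕-cancelʳ tip (v x)) (span-⊕ p (span-∈ x∈C))))
      , (λ (j , p) → edge≢all-ones j (⊕≡0⇒≡ (trans (sym (lincomb-⁅⁆⊻ K4edge j matching))
          (cycle (⁅ j ⁆ ⊻ matching) (subst (Span v C) (trans (⊕-cancelˡ (v x) _) (sym (lincomb-⁅⁆⊻ (v ∘ ψ) j matching)))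
            (span-⊕ (span-∈ x∈C) (subst (Span v C) (⊕-assoc (v x) (v (ψ j)) (Σψ matching)) (combine p tip⊕Σm))))))))
      ]′ (partner-closed x (q⊆p∪q (img ψ full) C x x∈C))

    ⟨C⟩≡0 : ∀ {w} → Span v C w → w ≡ zeroV
    ⟨C⟩≡0 = span-∅ v C≐∅

    base-≢ : ∀ a c → a ≢ c → lincomb K4edge ((⁅ a ⁆ ⊻ ⁅ c ⁆) ⊻ matching) ≢ zeroV → base (ψ a) ≢ base (ψ c)
    base-≢ a c a≢c not-cycle base≡ with tail-kernel (v (ψ a) ⊕ v (ψ c))
      (trans (tail-⊕ (v (ψ a)) (v (ψ c))) (trans (cong₂ _⊕_ (tail-vec (ψ a)) (tail-vec (ψ c)))
        (trans (cong (λ y → vec N y ⊕ vec N (base (ψ c))) base≡) (⊕-self _))))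
    ... | inj₁ Σ≡0   = a≢c (copy-injective (distinct tipless (⊕≡0⇒≡ Σ≡0)))
    ... | inj₂ Σ≡tip = not-cycle (cycle ((⁅ a ⁆ ⊻ ⁅ c ⁆) ⊻ matching) (subst (Span v C) (sym Σ≡0) span-0))
      where
      Σ≡0 : Σψ ((⁅ a ⁆ ⊻ ⁅ c ⁆) ⊻ matching) ≡ zeroV
      Σ≡0 = trans (lincomb-pair⊻ (v ∘ ψ) a c matching) (trans (cong (_⊕ Σψ matching) Σ≡tip) (⟨C⟩≡0 tip⊕Σm))

    tail-Σψ : ∀ a → tail (Σψ a) ≡ lincomb (vec N ∘ base ∘ ψ) a
    tail-Σψ a = trans (sym (lincomb-map tail tail-⊕ refl (v ∘ ψ) a)) (lincomb-cong-on a λ i _ → tail-vec (ψ i))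

    triangle-sum : vec N (base (ψ e01)) ⊕ vec N (base (ψ e02)) ≡ vec N (base (ψ e12))
    triangle-sum = ⊕≡0⇒≡ (begin
      (vec N (base (ψ e01)) ⊕ vec N (base (ψ e02))) ⊕ vec N (base (ψ e12))
        ≡⟨ ⊕-assoc _ _ _ ⟩
      vec N (base (ψ e01)) ⊕ (vec N (base (ψ e02)) ⊕ vec N (base (ψ e12)))
        ≡⟨ cong (λ y → vec N (base (ψ e01)) ⊕ (vec N (base (ψ e02)) ⊕ y)) (⊕-identityʳ _) ⟨
      lincomb (vec N ∘ base ∘ ψ) triangle₀₁₂
        ≡⟨ tail-Σψ triangle₀₁₂ ⟨
      tail (Σψ triangle₀₁₂)
        ≡⟨ cong tail (⟨C⟩≡0 (from (span⇔cycle triangle₀₁₂) refl)) ⟩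
      zeroV
        ∎)
      where open ≡-Reasoning

    triangle : Triangle-in-N
    triangle = base (ψ e01) , base (ψ e02) , base (ψ e12) ,
      sum⇒Triangle N triangle-sum (base-≢ e01 e02 (λ ()) (λ ())) (base-≢ e01 e12 (λ ()) (λ ())) (base-≢ e02 e12 (λ ()) (λ ()))

  triangle-or-cone-presentation : Triangle-in-N ⊎ ConePresentation
  triangle-or-cone-presentation with span? v C tip
  ... | yes tip∈⟨C⟩ = inj₂ (tip-in-⟨C⟩ tip∈⟨C⟩)
  ... | no  tip∉⟨C⟩ with span? v Q tip
  ...   | yes tip∈⟨Q⟩ = inj₁ (TipBetween.triangle tip∈⟨Q⟩ tip∉⟨C⟩)
  ...   | no  tip∉⟨Q⟩ = inj₂ (tip-outside tip∉⟨Q⟩)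

lemma4p5 : (N : SBM) → InN N → TriangleFree N → InN (TiplessCone N)
lemma4p5 N K4∉N triangle-free K4≤tipless with TipPosition.triangle-or-cone-presentation N (linear-presentation P)
  where P = presentation K4≤tipless
... | inj₁ (i , j , k , triangle) = triangle-free i j k triangle
... | inj₂ (C′ , cone-P) = K4∉N (presentation⇒IndMinor zero (contract-presentation cone-P refl (Cone.cone-contraction N d)))
  where d = Cone.base N (Presentation.copy (presentation K4≤tipless) zero)
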